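{- Let $p$ be a prime and $\mathcal{E}\subset\mathbb{F}_p^2$. Then $$|Q(\mathcal{E})|\ll |\Delta(\mathcal{E})|\left(\square(\mathcal{E})+|\mathcal{E}|^2\right).$$
   Context: For $x=(x_1,x_2)\in\mathbb{F}_p^2$ write $\|x\|:=x_1^2+x_2^2$, and $\Delta(\mathcal{E}):=\{\|x-y\|:x,y\in\mathcal{E}\}$. For $a,b\in\mathcal{E}$ with $\|a-b\|\neq0$, $l_{ab}$ is the line $\{x\in\mathbb{F}_p^2: x\cdot 2(b-a)=\|b\|-\|a\|\}$ (the bisector of $a$ and $b$, i.e. the set of $x$ with $\|x-a\|=\|x-b\|$). $Q(\mathcal{E}):=\{(a,b,c,d)\in\mathcal{E}^4:\ \|a-b\|\ne0,\ \|c-d\|\ne0,\ l_{ab}=l_{cd}\}$. A triple $(a,b,c)$ of points is a corner if $(b-a)\cdot(c-a)=0$; a quadruple $(a,b,c,d)$ forms a rectangle if $(a,b,d),(b,a,c),(c,b,d),(d,a,c)$ are all corners, and it is non-degenerate if not all its vertices lie on a line. $\square(\mathcal{E})$ is the number of non-degenerate rectangles with all vertices in $\mathcal{E}$. $X\ll Y$ means $X\le CY$ for an absolute constant $C$ independent of $p$. -}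

module Defs where

open import Data.Nat using (ℕ; zero; suc; _+_; _*_; _∸_; _≡ᵇ_; NonZero)
open import Data.Nat.DivMod using (_%_)
open import Data.Fin using (Fin; toℕ)
open import Data.List using (List; allFin; cartesianProduct; map; concatMap)
open import Data.Nat.ListAction using (sum)
open import Data.Bool.ListAction using (any; all)
open import Data.Bool using (Bool; true; false; _∧_; not; if_then_else_)
open import Data.Product using (_×_; _,_)

-- Elements of F_p are represented by Fin p (the residues 0..p-1);
-- intermediate arithmetic is done on ℕ representatives and compared mod p.
module _ (p : ℕ) {{_ : NonZero p}} where

  Pt : Set
  Pt = Fin p × Fin p

  _≈_ : ℕ → ℕ → Bool
  x ≈ y = (x % p) ≡ᵇ (y % p)

  neg : ℕ → ℕ
  neg x = p ∸ (x % p)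

  _⊖_ : ℕ → ℕ → ℕ
  x ⊖ y = x + neg y

  Vec2 : Set
  Vec2 = ℕ × ℕ

  vsub : Pt → Pt → Vec2
  vsub (b₁ , b₂) (a₁ , a₂) = (toℕ b₁ ⊖ toℕ a₁ , toℕ b₂ ⊖ toℕ a₂)

  dot : Vec2 → Vec2 → ℕ
  dot (x₁ , x₂) (y₁ , y₂) = x₁ * y₁ + x₂ * y₂

  emb : Pt → Vec2
  emb (x₁ , x₂) = (toℕ x₁ , toℕ x₂)

  norm : Vec2 → ℕ
  norm v = dot v v

  dist : Pt → Pt → ℕ
  dist x y = norm (vsub x y)

  points : List Pt
  points = cartesianProduct (allFin p) (allFin p)

  count : {A : Set} → (A → Bool) → List A → ℕ
  count f xs = sum (map (λ x → if f x then 1 else 0) xs)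

  Subset : Set
  Subset = Pt → Bool

  card : Subset → ℕ
  card E = count E points

  Δcard : Subset → ℕ
  Δcard E = count (λ t → any (λ x → any (λ y → E x ∧ E y ∧ (dist x y ≈ toℕ t)) points) points)
                  (allFin p)

  bisector : Pt → Pt → Subset
  bisector a b x with vsub b a
  ... | (v₁ , v₂) = dot (emb x) (2 * v₁ , 2 * v₂) ≈ (norm (emb b) ⊖ norm (emb a))

  sameSet : Subset → Subset → Bool
  sameSet S T = all (λ x → (S x ∧ T x) Data.Bool.∨ (not (S x) ∧ not (T x))) points

  quads : List (Pt × Pt × Pt × Pt)
  quads = concatMap (λ a → concatMap (λ b → concatMap (λ c → map (λ d → (a , b , c , d))
            points) points) points) points

  inE4 : Subset → Pt × Pt × Pt × Pt → Bool
  inE4 E (a , b , c , d) = E a ∧ E b ∧ E c ∧ E d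

  Qcard : Subset → ℕ
  Qcard E = count (λ { (a , b , c , d) → inE4 E (a , b , c , d)
                        ∧ not (dist a b ≈ 0) ∧ not (dist c d ≈ 0)
                        ∧ sameSet (bisector a b) (bisector c d) }) quads

  corner : Pt → Pt → Pt → Bool
  corner a b c = dot (vsub b a) (vsub c a) ≈ 0

  rectangle : Pt → Pt → Pt → Pt → Bool
  rectangle a b c d = corner a b d ∧ corner b a c ∧ corner c b d ∧ corner d a c

  onLine : Pt → Fin p → Pt → Bool
  onLine v t x = dot (emb v) (emb x) ≈ toℕ t

  nonzeroPt : Pt → Bool
  nonzeroPt v = not (dot (emb v) (emb v) ≡ᵇ 0)   -- representatives are < p, so this is v ≠ (0,0)

  allOnALine : Pt → Pt → Pt → Pt → Bool
  allOnALine a b c d = any (λ v → nonzeroPt v ∧ any (λ t →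
      onLine v t a ∧ onLine v t b ∧ onLine v t c ∧ onLine v t d) (allFin p)) points

  rectCard : Subset → ℕ
  rectCard E = count (λ { (a , b , c , d) → inE4 E (a , b , c , d)
                        ∧ rectangle a b c d ∧ not (allOnALine a b c d) }) quads

module Submission where

-- Call a pair (a, b) of points of E admissible if ‖a - b‖ ≠ 0. The relation l_ab = l_cd is an
-- equivalence on admissible pairs, so |Q(E)| is the sum of the squares of its class sizes. Splitting a
-- class according to the value of ‖a - b‖ ∈ Δ(E), Cauchy–Schwarz bounds the square of its size by |Δ(E)|
-- times the number of pairs of pairs in it with equal lengths. For odd p such pairs of pairs are rare:
-- l_ab determines the direction of b - a and the projection of the midpoint of ab on it, so equal
-- bisectors and equal lengths force d - c = ±(b - a) with (c - a)·(b - a) = 0 resp. (d - a)·(b - a) = 0,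
-- i.e. {c, d} = {a, b} or abdc resp. abcd is a non-degenerate rectangle. This gives at most
-- 2|E|² + 2□(E) such pairs of pairs. For p = 2 the plane has four points and the trivial count suffices.

open import Data.Bool using (Bool; true; false; T; _∧_; not)
open import Data.Bool.Properties using (T-∧; T-≡)
open import Data.Nat using (ℕ; NonZero)
open import Data.Product using (_,_)
open import Function using (Equivalence)
open import Relation.Binary.PropositionalEquality using (_≡_)
open import Relation.Nullary using (¬_; Dec; does; yes)

T⇒≡ : ∀ {x} → T x → x ≡ true
T⇒≡ = Equivalence.to T-≡

≡⇒T : ∀ {x} → x ≡ true → T x
≡⇒T = Equivalence.from T-≡

T-∧⁺ : ∀ {x y} → T x → T y → T (x ∧ y)
T-∧⁺ Tx Ty = Equivalence.from T-∧ (Tx , Ty)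

T-not⁺ : ∀ {x} → ¬ T x → T (not x)
T-not⁺ {false} _  = _
T-not⁺ {true}  ¬T = ¬T _

T-not⁻ : ∀ {x} → T (not x) → ¬ T x
T-not⁻ {true} () _

T-does⇒ : ∀ {A : Set} (d : Dec A) → T (does d) → A
T-does⇒ (yes a) _ = a

module FiniteSums where

  open import Data.Bool using (if_then_else_)
  open import Data.Fin using (Fin; zero; suc)
  open import Data.Fin.Properties using (_≟_)
  open import Data.List using (List; []; _∷_; map; concatMap; allFin; cartesianProduct; _++_)
  open import Data.List.Properties using (map-++; map-tabulate)
  open import Data.List.Membership.Propositional using (_∈_)
  open import Data.List.Relation.Unary.Any using (here; there)
  open import Data.Nat using (zero; suc; _+_; _*_; _∸_; _≤_; _<_; z≤n; s≤s; _≡ᵇ_)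
  open import Data.Nat.ListAction using (sum)
  open import Data.Nat.ListAction.Properties using (sum-++)
  open import Data.Nat.Properties hiding (_≟_)
  open import Data.Nat.Tactic.RingSolver using (solve-∀)
  open import Data.Product using (_×_; _,_; ∃)
  open import Data.Sum using (inj₁; inj₂)
  open import Function using (_∘_; id)
  open import Relation.Binary.PropositionalEquality

  𝟙 : Bool → ℕ
  𝟙 b = if b then 1 else 0

  𝟙-∧ : ∀ x y → 𝟙 (x ∧ y) ≡ 𝟙 x * 𝟙 y
  𝟙-∧ true  y = sym (+-identityʳ (𝟙 y))
  𝟙-∧ false y = refl

  𝟙≤1 : ∀ x → 𝟙 x ≤ 1
  𝟙≤1 true  = ≤-refl
  𝟙≤1 false = z≤n

  𝟙-∧-≤ : ∀ x y z → 𝟙 (x ∧ y ∧ z) ≤ 𝟙 (x ∧ y)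
  𝟙-∧-≤ true  true  z = 𝟙≤1 z
  𝟙-∧-≤ true  false z = z≤n
  𝟙-∧-≤ false y     z = z≤n

  T⇒1≤𝟙 : ∀ {x} → T x → 1 ≤ 𝟙 x
  T⇒1≤𝟙 {true} _ = ≤-refl

  𝟙>0⇒true : ∀ {x} → 0 < 𝟙 x → x ≡ true
  𝟙>0⇒true {true} _ = refl

  𝟙⁴≤ : ∀ x y z w {k} → (T x → T y → T z → T w → 1 ≤ k) → 𝟙 x * (𝟙 y * (𝟙 z * 𝟙 w)) ≤ k
  𝟙⁴≤ true  true  true  true  bound = bound _ _ _ _
  𝟙⁴≤ false _     _     _     bound = z≤n
  𝟙⁴≤ true  false _     _     bound = z≤n
  𝟙⁴≤ true  true  false _     bound = z≤n
  𝟙⁴≤ true  true  true  false bound = z≤n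

  ∑ : {A : Set} → List A → (A → ℕ) → ℕ
  ∑ xs f = sum (map f xs)

  syntax ∑ xs (λ x → e) = ∑[ x ∈ xs ] e

  variable
    A B : Set

  ∑-cong : {f g : A → ℕ} → (∀ x → f x ≡ g x) → ∀ xs → ∑ xs f ≡ ∑ xs g
  ∑-cong f≗g []       = refl
  ∑-cong f≗g (x ∷ xs) = cong₂ _+_ (f≗g x) (∑-cong f≗g xs)

  ∑-mono-≤ : {f g : A → ℕ} → (∀ x → f x ≤ g x) → ∀ xs → ∑ xs f ≤ ∑ xs g
  ∑-mono-≤ f≤g []       = z≤n
  ∑-mono-≤ f≤g (x ∷ xs) = +-mono-≤ (f≤g x) (∑-mono-≤ f≤g xs)

  ∑-0 : ∀ (xs : List A) → ∑[ x ∈ xs ] 0 ≡ 0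
  ∑-0 []       = refl
  ∑-0 (x ∷ xs) = ∑-0 xs

  ∑-distrib-+ : ∀ (f g : A → ℕ) xs → ∑[ x ∈ xs ] (f x + g x) ≡ ∑ xs f + ∑ xs g
  ∑-distrib-+ f g []       = refl
  ∑-distrib-+ f g (x ∷ xs) =
    trans (cong (f x + g x +_) (∑-distrib-+ f g xs)) (interchange (f x) (g x) (∑ xs f) (∑ xs g))
    where
    interchange : ∀ a b c d → a + b + (c + d) ≡ a + c + (b + d)
    interchange = solve-∀

  ∑-*ˡ : ∀ c (f : A → ℕ) xs → ∑[ x ∈ xs ] (c * f x) ≡ c * ∑ xs f
  ∑-*ˡ c f []       = sym (*-zeroʳ c)
  ∑-*ˡ c f (x ∷ xs) = trans (cong (c * f x +_) (∑-*ˡ c f xs)) (sym (*-distribˡ-+ c (f x) (∑ xs f)))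

  ∑-*ʳ : ∀ c (f : A → ℕ) xs → ∑[ x ∈ xs ] (f x * c) ≡ ∑ xs f * c
  ∑-*ʳ c f xs = trans (∑-cong (λ x → *-comm (f x) c) xs) (trans (∑-*ˡ c f xs) (*-comm c (∑ xs f)))

  ∑-++ : ∀ (f : A → ℕ) xs ys → ∑ (xs ++ ys) f ≡ ∑ xs f + ∑ ys f
  ∑-++ f xs ys = trans (cong sum (map-++ f xs ys)) (sum-++ (map f xs) (map f ys))

  ∑-map : ∀ (f : B → ℕ) (g : A → B) xs → ∑ (map g xs) f ≡ ∑ xs (f ∘ g)
  ∑-map f g []       = refl
  ∑-map f g (x ∷ xs) = cong (f (g x) +_) (∑-map f g xs)

  ∑-concatMap : ∀ (f : B → ℕ) (g : A → List B) xs → ∑ (concatMap g xs) f ≡ ∑[ x ∈ xs ] ∑ (g x) f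
  ∑-concatMap f g []       = refl
  ∑-concatMap f g (x ∷ xs) =
    trans (∑-++ f (g x) (concatMap g xs)) (cong (∑ (g x) f +_) (∑-concatMap f g xs))

  ∑-cartesianProduct : ∀ (f : A × B → ℕ) xs ys →
    ∑ (cartesianProduct xs ys) f ≡ ∑[ x ∈ xs ] ∑[ y ∈ ys ] f (x , y)
  ∑-cartesianProduct f []       ys = refl
  ∑-cartesianProduct f (x ∷ xs) ys = trans (∑-++ f (map (x ,_) ys) (cartesianProduct xs ys))
    (cong₂ _+_ (∑-map f (x ,_) ys) (∑-cartesianProduct f xs ys))

  ∑-comm : ∀ (f : A → B → ℕ) xs ys → ∑[ x ∈ xs ] ∑[ y ∈ ys ] f x y ≡ ∑[ y ∈ ys ] ∑[ x ∈ xs ] f x y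
  ∑-comm f []       ys = sym (∑-0 ys)
  ∑-comm f (x ∷ xs) ys = trans (cong (∑ ys (f x) +_) (∑-comm f xs ys))
    (sym (∑-distrib-+ (f x) (λ y → ∑[ x ∈ xs ] f x y) ys))

  ∈⇒≤∑ : ∀ (f : A → ℕ) {x xs} → x ∈ xs → f x ≤ ∑ xs f
  ∈⇒≤∑ f {xs = y ∷ xs} (here refl) = m≤m+n (f y) (∑ xs f)
  ∈⇒≤∑ f {xs = y ∷ xs} (there x∈)  = ≤-trans (∈⇒≤∑ f x∈) (m≤n+m (∑ xs f) (f y))

  ∑>0⇒∃>0 : ∀ (f : A → ℕ) xs → 0 < ∑ xs f → ∃ λ x → x ∈ xs × 0 < f x
  ∑>0⇒∃>0 f (x ∷ xs) ∑>0 with f x in fx≡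
  ... | suc _ = x , here refl , subst (0 <_) (sym fx≡) (s≤s z≤n)
  ... | zero  with y , y∈ , fy>0 ← ∑>0⇒∃>0 f xs ∑>0 = y , there y∈ , fy>0

  ∑-𝟙*-empty : ∀ (w : A → Bool) (f : A → ℕ) xs →
    ∑[ x ∈ xs ] 𝟙 (w x) ≡ 0 → ∑[ x ∈ xs ] (𝟙 (w x) * f x) ≡ 0
  ∑-𝟙*-empty w f []       _ = refl
  ∑-𝟙*-empty w f (x ∷ xs) ∑≡0 with w x
  ... | false = ∑-𝟙*-empty w f xs ∑≡0

  ∑-allFin-suc : ∀ {n} (f : Fin (suc n) → ℕ) → ∑ (allFin (suc n)) f ≡ f zero + ∑[ i ∈ allFin n ] f (suc i)
  ∑-allFin-suc {n} f =
    cong (f zero +_) (trans (cong (λ is → ∑ is f) (sym (map-tabulate id suc))) (∑-map f suc (allFin n)))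

  ∑-δ : ∀ {n} (j : Fin n) (h : Fin n → ℕ) → ∑[ i ∈ allFin n ] (𝟙 (does (i ≟ j)) * h i) ≡ h j
  ∑-δ {suc n} zero    h = trans (∑-allFin-suc (λ i → 𝟙 (does (i ≟ zero)) * h i))
    (trans (cong (h zero + 0 +_) (∑-0 (allFin n))) (trans (+-identityʳ _) (+-identityʳ _)))
  ∑-δ {suc n} (suc j) h = trans (∑-allFin-suc (λ i → 𝟙 (does (i ≟ suc j)) * h i)) (∑-δ j (h ∘ suc))

  2m[m+d]≤m²+[m+d]² : ∀ m d → 2 * (m * (m + d)) ≤ m * m + (m + d) * (m + d)
  2m[m+d]≤m²+[m+d]² m d = subst (2 * (m * (m + d)) ≤_) (expand m d) (m≤m+n _ (d * d))
    where
    expand : ∀ m d → 2 * (m * (m + d)) + d * d ≡ m * m + (m + d) * (m + d)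
    expand = solve-∀

  2mn≤m²+n² : ∀ m n → 2 * (m * n) ≤ m * m + n * n
  2mn≤m²+n² m n with ≤-total m n
  ... | inj₁ m≤n = subst (λ k → 2 * (m * k) ≤ m * m + k * k) (m+[n∸m]≡n m≤n) (2m[m+d]≤m²+[m+d]² m (n ∸ m))
  ... | inj₂ n≤m = subst₂ _≤_ (cong (2 *_) (*-comm n m)) (+-comm (n * n) (m * m))
    (subst (λ k → 2 * (n * k) ≤ n * n + k * k) (m+[n∸m]≡n n≤m) (2m[m+d]≤m²+[m+d]² n (m ∸ n)))

  square-step : ∀ u s m q → s * s ≤ m * q → (u + s) * (u + s) ≤ (1 + m) * (u * u + q)
  square-step u s m q s²≤mq = begin
    (u + s) * (u + s)                 ≡⟨ expand u s ⟩
    u * u + 2 * (u * s) + s * s       ≤⟨ +-mono-≤ (+-monoʳ-≤ (u * u) (cross-term u s m q s²≤mq)) s²≤mq ⟩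
    u * u + (q + m * (u * u)) + m * q ≡⟨ collect u m q ⟩
    (1 + m) * (u * u + q)             ∎
    where
    open ≤-Reasoning
    expand : ∀ u s → (u + s) * (u + s) ≡ u * u + 2 * (u * s) + s * s
    expand = solve-∀
    collect : ∀ u m q → u * u + (q + m * (u * u)) + m * q ≡ (1 + m) * (u * u + q)
    collect = solve-∀
    cross-term : ∀ u s m q → s * s ≤ m * q → 2 * (u * s) ≤ q + m * (u * u)
    cross-term u zero    zero q _ rewrite *-zeroʳ u = z≤n
    cross-term u s    m@(suc _) q s²≤mq = *-cancelˡ-≤ m (begin
      m * (2 * (u * s))         ≡⟨ shuffle m u s ⟩
      2 * ((m * u) * s)         ≤⟨ 2mn≤m²+n² (m * u) s ⟩
      (m * u) * (m * u) + s * s ≤⟨ +-monoʳ-≤ ((m * u) * (m * u)) s²≤mq ⟩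
      (m * u) * (m * u) + m * q ≡⟨ factor m u q ⟩
      m * (q + m * (u * u))     ∎)
      where
      shuffle : ∀ m u s → m * (2 * (u * s)) ≡ 2 * ((m * u) * s)
      shuffle = solve-∀
      factor : ∀ m u q → (m * u) * (m * u) + m * q ≡ m * (q + m * (u * u))
      factor = solve-∀

  ∑²≤support*∑-squares : ∀ (k : A → ℕ) xs →
    ∑ xs k * ∑ xs k ≤ ∑[ t ∈ xs ] 𝟙 (not (k t ≡ᵇ 0)) * ∑[ t ∈ xs ] (k t * k t)
  ∑²≤support*∑-squares k []       = z≤n
  ∑²≤support*∑-squares k (x ∷ xs) with k x
  ... | zero  = ∑²≤support*∑-squares k xs
  ... | suc u = square-step (suc u) (∑ xs k) (∑[ t ∈ xs ] 𝟙 (not (k t ≡ᵇ 0))) (∑[ t ∈ xs ] (k t * k t))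
                  (∑²≤support*∑-squares k xs)

  module LabelledClasses {A : Set} (X : List A) (R : A → A → Bool)
    (R-refl : ∀ x → R x x ≡ true)
    (R-sym : ∀ x y → R x y ≡ true → R y x ≡ true)
    (R-trans : ∀ x y z → R x y ≡ true → R y z ≡ true → R x z ≡ true)
    {n : ℕ} (label : A → Fin n) where

    size : (A → Bool) → ℕ
    size w = ∑[ x ∈ X ] 𝟙 (w x)

    relatedSum : (A → Bool) → (A → A → ℕ) → ℕ
    relatedSum w h = ∑[ x ∈ X ] ∑[ y ∈ X ] (𝟙 (w x) * (𝟙 (w y) * (𝟙 (R x y) * h x y)))

    sameLabel : A → A → ℕ
    sameLabel x y = 𝟙 (does (label x ≟ label y))

    labelCount : (Fin n → Bool) → ℕ
    labelCount used = ∑[ t ∈ allFin n ] 𝟙 (used t)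

    LabelsIn : (A → Bool) → (Fin n → Bool) → Set
    LabelsIn w used = ∀ x → w x ≡ true → used (label x) ≡ true

    relatedSum-empty : ∀ w h → size w ≡ 0 → relatedSum w h ≡ 0
    relatedSum-empty w h size≡0 = trans (∑-cong (λ x → ∑-*ˡ (𝟙 (w x)) _ X) X) (∑-𝟙*-empty w _ X size≡0)

    relatedSum≤size² : ∀ w h → (∀ x y → h x y ≤ 1) → relatedSum w h ≤ size w * size w
    relatedSum≤size² w h h≤1 = begin
      relatedSum w h                                ≤⟨ ∑-mono-≤ (λ x → ∑-mono-≤ (term≤ x) X) X ⟩
      ∑[ x ∈ X ] ∑[ y ∈ X ] (𝟙 (w x) * 𝟙 (w y))    ≡⟨ ∑-cong (λ x → ∑-*ˡ (𝟙 (w x)) (λ y → 𝟙 (w y)) X) X ⟩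
      ∑[ x ∈ X ] (𝟙 (w x) * size w)                 ≡⟨ ∑-*ʳ (size w) (λ x → 𝟙 (w x)) X ⟩
      size w * size w                               ∎
      where
      open ≤-Reasoning
      term≤ : ∀ x y → 𝟙 (w x) * (𝟙 (w y) * (𝟙 (R x y) * h x y)) ≤ 𝟙 (w x) * 𝟙 (w y)
      term≤ x y = *-monoʳ-≤ (𝟙 (w x)) (≤-trans (*-monoʳ-≤ (𝟙 (w y)) (*-mono-≤ (𝟙≤1 (R x y)) (h≤1 x y)))
                                               (≤-reflexive (*-identityʳ (𝟙 (w y)))))

    module _ (w : A → Bool) (x₀ : A) where

      classOf rest : A → Bool
      classOf x = w x ∧ R x₀ x
      rest    x = w x ∧ not (R x₀ x)

      size-split : size w ≡ size classOf + size rest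
      size-split = trans (∑-cong split X) (∑-distrib-+ _ _ X)
        where
        split : ∀ x → 𝟙 (w x) ≡ 𝟙 (classOf x) + 𝟙 (rest x)
        split x with w x | R x₀ x
        ... | false | _     = refl
        ... | true  | true  = refl
        ... | true  | false = refl

      -- Related pairs never straddle the class of x₀, by transitivity.
      relatedSum-split : ∀ h → relatedSum w h ≡ relatedSum classOf h + relatedSum rest h
      relatedSum-split h =
        trans (∑-cong (λ x → trans (∑-cong (split x) X) (∑-distrib-+ _ _ X)) X) (∑-distrib-+ _ _ X)
        where
        split : ∀ x y → 𝟙 (w x) * (𝟙 (w y) * (𝟙 (R x y) * h x y))
                      ≡ 𝟙 (classOf x) * (𝟙 (classOf y) * (𝟙 (R x y) * h x y))
                        + 𝟙 (rest x) * (𝟙 (rest y) * (𝟙 (R x y) * h x y))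
        split x y with w x | w y | R x₀ x in x₀x | R x₀ y in x₀y | R x y in xy
        ... | false | _     | _     | _     | _     = refl
        ... | true  | false | true  | _     | _     = sym (+-identityʳ _)
        ... | true  | false | false | _     | _     = refl
        ... | true  | true  | true  | true  | _     = sym (+-identityʳ _)
        ... | true  | true  | false | false | _     = refl
        ... | true  | true  | true  | false | false = refl
        ... | true  | true  | false | true  | false = refl
        ... | true  | true  | true  | false | true  with () ← trans (sym x₀y) (R-trans x₀ x y x₀x xy)
        ... | true  | true  | false | true  | true  with () ← trans (sym x₀x) (R-trans x₀ y x x₀y (R-sym x y xy))

    module _ (v : A → Bool) (clique : ∀ {x y} → v x ≡ true → v y ≡ true → R x y ≡ true) where

      relatedSum-clique : ∀ h → relatedSum v h ≡ ∑[ x ∈ X ] ∑[ y ∈ X ] (𝟙 (v x) * (𝟙 (v y) * h x y))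
      relatedSum-clique h = ∑-cong (λ x → ∑-cong (drop-R x) X) X
        where
        drop-R : ∀ x y → 𝟙 (v x) * (𝟙 (v y) * (𝟙 (R x y) * h x y)) ≡ 𝟙 (v x) * (𝟙 (v y) * h x y)
        drop-R x y with v x in vx | v y in vy
        ... | false | _     = refl
        ... | true  | false = refl
        ... | true  | true  rewrite clique vx vy = cong (λ m → 1 * (1 * m)) (*-identityˡ (h x y))

      relatedSum-clique-all : relatedSum v (λ _ _ → 1) ≡ size v * size v
      relatedSum-clique-all = trans (relatedSum-clique (λ _ _ → 1))
        (trans (∑-cong (λ x → trans (∑-*ˡ (𝟙 (v x)) _ X)
                                    (cong (𝟙 (v x) *_) (∑-cong (λ y → *-identityʳ (𝟙 (v y))) X))) X)
               (∑-*ʳ (size v) (λ x → 𝟙 (v x)) X))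

      perLabel : Fin n → ℕ
      perLabel t = ∑[ x ∈ X ] (𝟙 (v x) * 𝟙 (does (t ≟ label x)))

      ∑-perLabel : ∑ (allFin n) perLabel ≡ size v
      ∑-perLabel = trans (∑-comm (λ t x → 𝟙 (v x) * 𝟙 (does (t ≟ label x))) (allFin n) X)
        (∑-cong (λ x → trans (∑-*ˡ (𝟙 (v x)) _ (allFin n))
          (trans (cong (𝟙 (v x) *_) (trans (∑-cong (λ t → sym (*-identityʳ _)) (allFin n))
                                            (∑-δ (label x) (λ _ → 1))))
                 (*-identityʳ (𝟙 (v x))))) X)

      ∑-perLabel² : ∑[ t ∈ allFin n ] (perLabel t * perLabel t) ≡ relatedSum v sameLabel
      ∑-perLabel² = begin
        ∑[ t ∈ allFin n ] (perLabel t * perLabel t)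
          ≡⟨ ∑-cong (λ t → trans (sym (∑-*ʳ (perLabel t) _ X))
                                 (∑-cong (λ x → sym (∑-*ˡ (𝟙 (v x) * 𝟙 (does (t ≟ label x))) _ X)) X)) (allFin n) ⟩
        ∑[ t ∈ allFin n ] ∑[ x ∈ X ] ∑[ y ∈ X ] term t x y
          ≡⟨ ∑-comm _ (allFin n) X ⟩
        ∑[ x ∈ X ] ∑[ t ∈ allFin n ] ∑[ y ∈ X ] term t x y
          ≡⟨ ∑-cong (λ x → ∑-comm (λ t y → term t x y) (allFin n) X) X ⟩
        ∑[ x ∈ X ] ∑[ y ∈ X ] ∑[ t ∈ allFin n ] term t x y
          ≡⟨ ∑-cong (λ x → ∑-cong (∑-term x) X) X ⟩
        ∑[ x ∈ X ] ∑[ y ∈ X ] (𝟙 (v x) * (𝟙 (v y) * sameLabel x y))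
          ≡⟨ relatedSum-clique sameLabel ⟨
        relatedSum v sameLabel ∎
        where
        open ≡-Reasoning
        term : Fin n → A → A → ℕ
        term t x y = (𝟙 (v x) * 𝟙 (does (t ≟ label x))) * (𝟙 (v y) * 𝟙 (does (t ≟ label y)))
        ∑-term : ∀ x y → ∑[ t ∈ allFin n ] term t x y ≡ 𝟙 (v x) * (𝟙 (v y) * sameLabel x y)
        ∑-term x y = begin
          ∑[ t ∈ allFin n ] term t x y
            ≡⟨ ∑-cong (λ t → rearrange (𝟙 (v x)) _ (𝟙 (v y)) _) (allFin n) ⟩
          ∑[ t ∈ allFin n ] (𝟙 (v x) * (𝟙 (v y) * (𝟙 (does (t ≟ label x)) * 𝟙 (does (t ≟ label y)))))
            ≡⟨ trans (∑-*ˡ (𝟙 (v x)) _ (allFin n)) (cong (𝟙 (v x) *_) (∑-*ˡ (𝟙 (v y)) _ (allFin n))) ⟩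
          𝟙 (v x) * (𝟙 (v y) * ∑[ t ∈ allFin n ] (𝟙 (does (t ≟ label x)) * 𝟙 (does (t ≟ label y))))
            ≡⟨ cong (λ m → 𝟙 (v x) * (𝟙 (v y) * m)) (∑-δ (label x) (λ t → 𝟙 (does (t ≟ label y)))) ⟩
          𝟙 (v x) * (𝟙 (v y) * sameLabel x y) ∎
          where
          rearrange : ∀ a e b f → (a * e) * (b * f) ≡ a * (b * (e * f))
          rearrange = solve-∀

      clique-bound : ∀ used → LabelsIn v used →
        relatedSum v (λ _ _ → 1) ≤ labelCount used * relatedSum v sameLabel
      clique-bound used labels = begin
        relatedSum v (λ _ _ → 1)                        ≡⟨ relatedSum-clique-all ⟩
        size v * size v                                 ≡⟨ cong₂ _*_ ∑-perLabel ∑-perLabel ⟨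
        ∑ (allFin n) perLabel * ∑ (allFin n) perLabel   ≤⟨ ∑²≤support*∑-squares perLabel (allFin n) ⟩
        support * ∑[ t ∈ allFin n ] (perLabel t * perLabel t) ≤⟨ *-monoˡ-≤ _ (∑-mono-≤ support⊆used (allFin n)) ⟩
        labelCount used * ∑[ t ∈ allFin n ] (perLabel t * perLabel t) ≡⟨ cong (labelCount used *_) ∑-perLabel² ⟩
        labelCount used * relatedSum v sameLabel        ∎
        where
        open ≤-Reasoning
        support : ℕ
        support = ∑[ t ∈ allFin n ] 𝟙 (not (perLabel t ≡ᵇ 0))
        used-if-counted : ∀ t x → 0 < 𝟙 (v x) * 𝟙 (does (t ≟ label x)) → used t ≡ true
        used-if-counted t x counted with v x in vx | t ≟ label x
        ... | true | yes refl = labels x vx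
        support⊆used : ∀ t → 𝟙 (not (perLabel t ≡ᵇ 0)) ≤ 𝟙 (used t)
        support⊆used t with perLabel t in count≡
        ... | zero  = z≤n
        ... | suc _ with x , _ , counted ← ∑>0⇒∃>0 _ X (subst (0 <_) (sym count≡) (s≤s z≤n))
                    rewrite used-if-counted t x counted = ≤-refl

    classOf-clique : ∀ w x₀ {x y} → classOf w x₀ x ≡ true → classOf w x₀ y ≡ true → R x y ≡ true
    classOf-clique w x₀ {x} {y} x∈ y∈ = R-trans x x₀ y (R-sym x₀ x (related x∈)) (related y∈)
      where
      related : ∀ {z} → classOf w x₀ z ≡ true → R x₀ z ≡ true
      related {z} z∈ with w z | R x₀ z
      ... | true | true = refl

    LabelsIn-∧ : ∀ w used (f : A → Bool) → LabelsIn w used → LabelsIn (λ x → w x ∧ f x) used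
    LabelsIn-∧ w used f labels x wx∧fx with w x in wx
    ... | true = labels x wx

    relatedSum-bound-by-size : ∀ fuel w used → LabelsIn w used → size w ≤ fuel →
      relatedSum w (λ _ _ → 1) ≤ labelCount used * relatedSum w sameLabel
    relatedSum-bound-by-size fuel w used labels size≤ with size w in size≡
    ... | zero = subst (_≤ labelCount used * relatedSum w sameLabel) (sym (relatedSum-empty w _ size≡)) z≤n
    relatedSum-bound-by-size (suc fuel) w used labels (s≤s size≤) | suc k
      with x₀ , x₀∈X , wx₀>0 ← ∑>0⇒∃>0 (λ x → 𝟙 (w x)) X (subst (0 <_) (sym size≡) (s≤s z≤n)) = begin
      relatedSum w one                                       ≡⟨ relatedSum-split w x₀ one ⟩
      relatedSum class one + relatedSum others one           ≤⟨ +-mono-≤ class-bound others-bound ⟩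
      L * relatedSum class sameLabel + L * relatedSum others sameLabel
                                                             ≡⟨ *-distribˡ-+ L _ _ ⟨
      L * (relatedSum class sameLabel + relatedSum others sameLabel)
                                                             ≡⟨ cong (L *_) (relatedSum-split w x₀ sameLabel) ⟨
      L * relatedSum w sameLabel                             ∎
      where
      open ≤-Reasoning
      one : A → A → ℕ
      one _ _ = 1
      L : ℕ
      L = labelCount used
      class others : A → Bool
      class  = classOf w x₀
      others = rest w x₀
      class-bound : relatedSum class one ≤ L * relatedSum class sameLabel
      class-bound = clique-bound class (classOf-clique w x₀) used (LabelsIn-∧ w used (R x₀) labels)
      x₀∈class : 1 ≤ size class
      x₀∈class = subst (λ b → 𝟙 b ≤ size class) (cong₂ _∧_ (𝟙>0⇒true wx₀>0) (R-refl x₀))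
                   (∈⇒≤∑ (λ x → 𝟙 (class x)) x₀∈X)
      others-size : size others ≤ fuel
      others-size = +-cancelˡ-≤ 1 (size others) fuel (≤-trans (+-monoˡ-≤ (size others) x₀∈class)
                      (subst (_≤ suc fuel) (trans (sym size≡) (size-split w x₀)) (s≤s size≤)))
      others-bound : relatedSum others one ≤ L * relatedSum others sameLabel
      others-bound =
        relatedSum-bound-by-size fuel others used (LabelsIn-∧ w used (not ∘ R x₀) labels) others-size

    relatedSum-bound : ∀ w used → LabelsIn w used →
      relatedSum w (λ _ _ → 1) ≤ labelCount used * relatedSum w sameLabel
    relatedSum-bound w used labels = relatedSum-bound-by-size (size w) w used labels ≤-refl

module IntegerPlane where

  open import Data.Integer using (ℤ; +_; 0ℤ; 1ℤ; _+_; _-_; _*_; -_)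
  import Data.Integer.Properties as ℤ
  open import Data.Integer.Tactic.RingSolver using (solve-∀)
  open import Data.Product using (_×_; _,_)
  open import Relation.Binary.PropositionalEquality using (_≡_; cong₂)

  V : Set
  V = ℤ × ℤ

  infixl 6 _+ᵥ_ _-ᵥ_
  infixr 7 _*ᵥ_
  infix 8 _·_ _⊗_

  _+ᵥ_ _-ᵥ_ : V → V → V
  (x₁ , x₂) +ᵥ (y₁ , y₂) = x₁ + y₁ , x₂ + y₂
  (x₁ , x₂) -ᵥ (y₁ , y₂) = x₁ - y₁ , x₂ - y₂

  _*ᵥ_ : ℤ → V → V
  k *ᵥ (x₁ , x₂) = k * x₁ , k * x₂

  _·_ _⊗_ : V → V → ℤ
  (x₁ , x₂) · (y₁ , y₂) = x₁ * y₁ + x₂ * y₂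
  (x₁ , x₂) ⊗ (y₁ , y₂) = x₁ * y₂ - x₂ * y₁

  perp : V → V
  perp (x₁ , x₂) = - x₂ , x₁

  ·-comm : ∀ u v → u · v ≡ v · u
  ·-comm (u₁ , u₂) (v₁ , v₂) = cong₂ _+_ (ℤ.*-comm u₁ v₁) (ℤ.*-comm u₂ v₂)

  +ᵥ-comm : ∀ u v → u +ᵥ v ≡ v +ᵥ u
  +ᵥ-comm (u₁ , u₂) (v₁ , v₂) = cong₂ _,_ (ℤ.+-comm u₁ v₁) (ℤ.+-comm u₂ v₂)

  -- The ring solver does not unfold the vector operations, so each identity below is stated
  -- once on vectors and proved through its coordinate form.

  ·-distribˡ-sub : ∀ u v w → u · (v -ᵥ w) ≡ u · v - u · w
  ·-distribˡ-sub (u₁ , u₂) (v₁ , v₂) (w₁ , w₂) = coordinates u₁ u₂ v₁ v₂ w₁ w₂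
    where
    coordinates : ∀ u₁ u₂ v₁ v₂ w₁ w₂ →
      u₁ * (v₁ - w₁) + u₂ * (v₂ - w₂) ≡ (u₁ * v₁ + u₂ * v₂) - (u₁ * w₁ + u₂ * w₂)
    coordinates = solve-∀

  ·-self-swap : ∀ a b → (a -ᵥ b) · (a -ᵥ b) ≡ (b -ᵥ a) · (b -ᵥ a)
  ·-self-swap (a₁ , a₂) (b₁ , b₂) = coordinates a₁ a₂ b₁ b₂
    where
    coordinates : ∀ a₁ a₂ b₁ b₂ →
      (a₁ - b₁) * (a₁ - b₁) + (a₂ - b₂) * (a₂ - b₂) ≡ (b₁ - a₁) * (b₁ - a₁) + (b₂ - a₂) * (b₂ - a₂)
    coordinates = solve-∀

  ·-shift : ∀ u v k → u · (v +ᵥ k *ᵥ u) ≡ u · v + k * (u · u)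
  ·-shift (u₁ , u₂) (v₁ , v₂) k = coordinates u₁ u₂ v₁ v₂ k
    where
    coordinates : ∀ u₁ u₂ v₁ v₂ k →
      u₁ * (v₁ + k * u₁) + u₂ * (v₂ + k * u₂) ≡ (u₁ * v₁ + u₂ * v₂) + k * (u₁ * u₁ + u₂ * u₂)
    coordinates = solve-∀

  ⊗-shift : ∀ u v k → u ⊗ (v +ᵥ k *ᵥ u) ≡ u ⊗ v
  ⊗-shift (u₁ , u₂) (v₁ , v₂) k = coordinates u₁ u₂ v₁ v₂ k
    where
    coordinates : ∀ u₁ u₂ v₁ v₂ k → u₁ * (v₂ + k * u₂) - u₂ * (v₁ + k * u₁) ≡ u₁ * v₂ - u₂ * v₁
    coordinates = solve-∀

  binet-cauchy : ∀ u v w → (u ⊗ v) * (u ⊗ w) ≡ (u · u) * (v · w) - (u · v) * (u · w)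
  binet-cauchy (u₁ , u₂) (v₁ , v₂) (w₁ , w₂) = coordinates u₁ u₂ v₁ v₂ w₁ w₂
    where
    coordinates : ∀ u₁ u₂ v₁ v₂ w₁ w₂ →
      (u₁ * v₂ - u₂ * v₁) * (u₁ * w₂ - u₂ * w₁)
        ≡ (u₁ * u₁ + u₂ * u₂) * (v₁ * w₁ + v₂ * w₂) - (u₁ * v₁ + u₂ * v₂) * (u₁ * w₁ + u₂ * w₂)
    coordinates = solve-∀

  decompose : ∀ u w → (u · u) *ᵥ w ≡ (u · w) *ᵥ u +ᵥ (u ⊗ w) *ᵥ perp u
  decompose (u₁ , u₂) (w₁ , w₂) = cong₂ _,_ (first u₁ u₂ w₁ w₂) (second u₁ u₂ w₁ w₂)
    where
    first : ∀ u₁ u₂ w₁ w₂ →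
      (u₁ * u₁ + u₂ * u₂) * w₁ ≡ (u₁ * w₁ + u₂ * w₂) * u₁ + (u₁ * w₂ - u₂ * w₁) * (- u₂)
    first = solve-∀
    second : ∀ u₁ u₂ w₁ w₂ →
      (u₁ * u₁ + u₂ * u₂) * w₂ ≡ (u₁ * w₁ + u₂ * w₂) * u₂ + (u₁ * w₂ - u₂ * w₁) * u₁
    second = solve-∀

  difference-of-squares : ∀ u v →
    (u · v + (- 1ℤ) * (u · u)) * (u · v + 1ℤ * (u · u)) ≡ (- (u ⊗ v)) * (u ⊗ v) + (- (u · u)) * (u · u - v · v)
  difference-of-squares (u₁ , u₂) (v₁ , v₂) = coordinates u₁ u₂ v₁ v₂
    where
    coordinates : ∀ u₁ u₂ v₁ v₂ →
      ((u₁ * v₁ + u₂ * v₂) + (- 1ℤ) * (u₁ * u₁ + u₂ * u₂)) * ((u₁ * v₁ + u₂ * v₂) + 1ℤ * (u₁ * u₁ + u₂ * u₂))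
        ≡ (- (u₁ * v₂ - u₂ * v₁)) * (u₁ * v₂ - u₂ * v₁)
          + (- (u₁ * u₁ + u₂ * u₂)) * ((u₁ * u₁ + u₂ * u₂) - (v₁ * v₁ + v₂ * v₂))
    coordinates = solve-∀

  no-offset : ∀ z u → (z -ᵥ z) · u ≡ 0ℤ
  no-offset (z₁ , z₂) (u₁ , u₂) = coordinates z₁ z₂ u₁ u₂
    where
    coordinates : ∀ z₁ z₂ u₁ u₂ → (z₁ - z₁) * u₁ + (z₂ - z₂) * u₂ ≡ 0ℤ
    coordinates = solve-∀

  perpendicular-offset : ∀ z u → ((z +ᵥ + 2 *ᵥ perp u) -ᵥ z) · u ≡ 0ℤ
  perpendicular-offset (z₁ , z₂) (u₁ , u₂) = coordinates z₁ z₂ u₁ u₂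
    where
    coordinates : ∀ z₁ z₂ u₁ u₂ → ((z₁ + + 2 * (- u₂)) - z₁) * u₁ + ((z₂ + + 2 * u₁) - z₂) * u₂ ≡ 0ℤ
    coordinates = solve-∀

  offset-difference : ∀ z y u v → ((z +ᵥ + 2 *ᵥ perp u) -ᵥ y) · v - (z -ᵥ y) · v ≡ + 2 * (u ⊗ v)
  offset-difference (z₁ , z₂) (y₁ , y₂) (u₁ , u₂) (v₁ , v₂) = coordinates z₁ z₂ y₁ y₂ u₁ u₂ v₁ v₂
    where
    coordinates : ∀ z₁ z₂ y₁ y₂ u₁ u₂ v₁ v₂ →
      (((z₁ + + 2 * (- u₂)) - y₁) * v₁ + ((z₂ + + 2 * u₁) - y₂) * v₂) - ((z₁ - y₁) * v₁ + (z₂ - y₂) * v₂)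
        ≡ + 2 * (u₁ * v₂ - u₂ * v₁)
    coordinates = solve-∀

  bisector-identity : ∀ x a b z →
    x · (+ 2 *ᵥ (b -ᵥ a)) - (b · b - a · a) ≡ (z -ᵥ (a +ᵥ b)) · (b -ᵥ a) + (b -ᵥ a) · (+ 2 *ᵥ x -ᵥ z)
  bisector-identity (x₁ , x₂) (a₁ , a₂) (b₁ , b₂) (z₁ , z₂) = coordinates x₁ x₂ a₁ a₂ b₁ b₂ z₁ z₂
    where
    coordinates : ∀ x₁ x₂ a₁ a₂ b₁ b₂ z₁ z₂ →
      (x₁ * (+ 2 * (b₁ - a₁)) + x₂ * (+ 2 * (b₂ - a₂))) - ((b₁ * b₁ + b₂ * b₂) - (a₁ * a₁ + a₂ * a₂))
        ≡ ((z₁ - (a₁ + b₁)) * (b₁ - a₁) + (z₂ - (a₂ + b₂)) * (b₂ - a₂))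
          + ((b₁ - a₁) * (+ 2 * x₁ - z₁) + (b₂ - a₂) * (+ 2 * x₂ - z₂))
    coordinates = solve-∀

  parallelogram-identity : ∀ a b c d →
    + 2 * ((b -ᵥ a) · (c -ᵥ a)) ≡ ((c +ᵥ d) -ᵥ (a +ᵥ b)) · (b -ᵥ a) - (b -ᵥ a) · ((d -ᵥ c) +ᵥ (- 1ℤ) *ᵥ (b -ᵥ a))
  parallelogram-identity (a₁ , a₂) (b₁ , b₂) (c₁ , c₂) (d₁ , d₂) = coordinates a₁ a₂ b₁ b₂ c₁ c₂ d₁ d₂
    where
    coordinates : ∀ a₁ a₂ b₁ b₂ c₁ c₂ d₁ d₂ →
      + 2 * ((b₁ - a₁) * (c₁ - a₁) + (b₂ - a₂) * (c₂ - a₂))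
        ≡ (((c₁ + d₁) - (a₁ + b₁)) * (b₁ - a₁) + ((c₂ + d₂) - (a₂ + b₂)) * (b₂ - a₂))
          - ((b₁ - a₁) * ((d₁ - c₁) + (- 1ℤ) * (b₁ - a₁)) + (b₂ - a₂) * ((d₂ - c₂) + (- 1ℤ) * (b₂ - a₂)))
    coordinates = solve-∀

  corner-identity-b : ∀ a b c d →
    (a -ᵥ b) · (d -ᵥ b) ≡ (- 1ℤ) * ((b -ᵥ a) · (c -ᵥ a)) + (a -ᵥ b) · ((d -ᵥ c) +ᵥ (- 1ℤ) *ᵥ (b -ᵥ a))
  corner-identity-b (a₁ , a₂) (b₁ , b₂) (c₁ , c₂) (d₁ , d₂) = coordinates a₁ a₂ b₁ b₂ c₁ c₂ d₁ d₂
    where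
    coordinates : ∀ a₁ a₂ b₁ b₂ c₁ c₂ d₁ d₂ →
      (a₁ - b₁) * (d₁ - b₁) + (a₂ - b₂) * (d₂ - b₂)
        ≡ (- 1ℤ) * ((b₁ - a₁) * (c₁ - a₁) + (b₂ - a₂) * (c₂ - a₂))
          + ((a₁ - b₁) * ((d₁ - c₁) + (- 1ℤ) * (b₁ - a₁)) + (a₂ - b₂) * ((d₂ - c₂) + (- 1ℤ) * (b₂ - a₂)))
    coordinates = solve-∀

  corner-identity-d : ∀ a b c d →
    (b -ᵥ d) · (c -ᵥ d) ≡ 1ℤ * ((b -ᵥ a) · (c -ᵥ a)) + (d -ᵥ a) · ((d -ᵥ c) +ᵥ (- 1ℤ) *ᵥ (b -ᵥ a))
  corner-identity-d (a₁ , a₂) (b₁ , b₂) (c₁ , c₂) (d₁ , d₂) = coordinates a₁ a₂ b₁ b₂ c₁ c₂ d₁ d₂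
    where
    coordinates : ∀ a₁ a₂ b₁ b₂ c₁ c₂ d₁ d₂ →
      (b₁ - d₁) * (c₁ - d₁) + (b₂ - d₂) * (c₂ - d₂)
        ≡ 1ℤ * ((b₁ - a₁) * (c₁ - a₁) + (b₂ - a₂) * (c₂ - a₂))
          + ((d₁ - a₁) * ((d₁ - c₁) + (- 1ℤ) * (b₁ - a₁)) + (d₂ - a₂) * ((d₂ - c₂) + (- 1ℤ) * (b₂ - a₂)))
    coordinates = solve-∀

  corner-identity-c : ∀ a b c d →
    (a -ᵥ c) · (d -ᵥ c) ≡ (- 1ℤ) * ((b -ᵥ a) · (c -ᵥ a)) + (a -ᵥ c) · ((d -ᵥ c) +ᵥ (- 1ℤ) *ᵥ (b -ᵥ a))
  corner-identity-c (a₁ , a₂) (b₁ , b₂) (c₁ , c₂) (d₁ , d₂) = coordinates a₁ a₂ b₁ b₂ c₁ c₂ d₁ d₂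
    where
    coordinates : ∀ a₁ a₂ b₁ b₂ c₁ c₂ d₁ d₂ →
      (a₁ - c₁) * (d₁ - c₁) + (a₂ - c₂) * (d₂ - c₂)
        ≡ (- 1ℤ) * ((b₁ - a₁) * (c₁ - a₁) + (b₂ - a₂) * (c₂ - a₂))
          + ((a₁ - c₁) * ((d₁ - c₁) + (- 1ℤ) * (b₁ - a₁)) + (a₂ - c₂) * ((d₂ - c₂) + (- 1ℤ) * (b₂ - a₂)))
    coordinates = solve-∀

  difference-via : ∀ a b d → d -ᵥ b ≡ (d -ᵥ a) +ᵥ (- 1ℤ) *ᵥ (b -ᵥ a)
  difference-via (a₁ , a₂) (b₁ , b₂) (d₁ , d₂) = cong₂ _,_ (coordinate a₁ b₁ d₁) (coordinate a₂ b₂ d₂)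
    where
    coordinate : ∀ a b d → d - b ≡ (d - a) + (- 1ℤ) * (b - a)
    coordinate = solve-∀

  reversed-difference : ∀ c d u → (c -ᵥ d) +ᵥ (- 1ℤ) *ᵥ u ≡ (- 1ℤ) *ᵥ ((d -ᵥ c) +ᵥ 1ℤ *ᵥ u)
  reversed-difference (c₁ , c₂) (d₁ , d₂) (u₁ , u₂) = cong₂ _,_ (coordinate c₁ d₁ u₁) (coordinate c₂ d₂ u₂)
    where
    coordinate : ∀ c d u → (c - d) + (- 1ℤ) * u ≡ (- 1ℤ) * ((d - c) + 1ℤ * u)
    coordinate = solve-∀

module ModularPlane (p : ℕ) ⦃ _ : NonZero p ⦄ where

  open import Data.Empty using (⊥-elim)
  open import Data.Fin using (Fin; toℕ; fromℕ<)
  open import Data.Fin.Properties using (toℕ-fromℕ<; toℕ-injective; toℕ<n) renaming (_≟_ to _≟ᶠ_)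
  open import Data.Integer using (ℤ; +_; -[1+_]; 0ℤ; 1ℤ; _+_; _-_; _*_; -_)
  import Data.Integer as Int
  import Data.Integer.Properties as ℤ
  open import Data.Integer.DivMod using (_%ℕ_; _/ℕ_; n%ℕd<d; a≡a%ℕn+[a/ℕn]*n)
  open import Data.Integer.Divisibility.Signed
    using (_∣_; divides; ∣m∣n⇒∣m+n; ∣m∣n⇒∣m-n; ∣m+n∣n⇒∣m; ∣n⇒∣m*n; ∣m⇒∣m*n; ∣m⇒∣-m; ∣⇒∣ᵤ; ∣ᵤ⇒∣)
  open import Data.Integer.Tactic.RingSolver using (solve-∀)
  open import Data.List using (allFin)
  open import Data.List.Relation.Unary.Any using (satisfied)
  open import Data.List.Relation.Unary.Any.Properties using (any⁻)
  open import Data.Nat as ℕ using (suc)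
  import Data.Nat.Divisibility as ℕ
  import Data.Nat.Properties as ℕ
  open import Data.Nat.DivMod using (_%_; _/_; m≡m%n+[m/n]*n; [m+kn]%n≡m%n; m%n<n; m<n⇒m%n≡m; m*n%n≡0)
  open import Data.Nat.Primality using (Prime; euclidsLemma; prime⇒nonTrivial; prime⇒irreducible)
  open import Data.Product using (_×_; _,_; proj₁; proj₂; ∃₂)
  open import Data.Product.Properties using (≡-dec)
  open import Data.Sum using (_⊎_; inj₁; inj₂; [_,_]′; map)
  open import Function using (_∘_; _⇔_; Equivalence; mk⇔)
  open import Relation.Binary.PropositionalEquality
  open import Relation.Nullary using (no)
  open import Defs renaming (_≈_ to sameMod)
  open IntegerPlane

  P : ℤ
  P = + p

  ∣-≡ : ∀ {x y} → x ≡ y → P ∣ y → P ∣ x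
  ∣-≡ refl P∣y = P∣y

  ∣0 : P ∣ 0ℤ
  ∣0 = divides 0ℤ refl

  ∣-lin : ∀ {x y} k l → P ∣ x → P ∣ y → P ∣ k * x + l * y
  ∣-lin k l P∣x P∣y = ∣m∣n⇒∣m+n (∣n⇒∣m*n k P∣x) (∣n⇒∣m*n l P∣y)

  infix 4 _≋_ _≋ᵥ_ _∣ᵥ_

  record _≋_ (x y : ℤ) : Set where
    constructor mk≋
    field ∣-difference : P ∣ x - y
  open _≋_ public

  ≋-refl : ∀ {x} → x ≋ x
  ≋-refl {x} = mk≋ (∣-≡ (ℤ.+-inverseʳ x) ∣0)

  ≋-sym : ∀ {x y} → x ≋ y → y ≋ x
  ≋-sym {x} {y} (mk≋ P∣x-y) = mk≋ (∣-≡ (flip x y) (∣m⇒∣-m P∣x-y))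
    where
    flip : ∀ x y → y - x ≡ - (x - y)
    flip = solve-∀

  ≋-trans : ∀ {x y z} → x ≋ y → y ≋ z → x ≋ z
  ≋-trans {x} {y} {z} (mk≋ P∣x-y) (mk≋ P∣y-z) = mk≋ (∣-≡ (split x y z) (∣m∣n⇒∣m+n P∣x-y P∣y-z))
    where
    split : ∀ x y z → x - z ≡ (x - y) + (y - z)
    split = solve-∀

  ≡⇒≋ : ∀ {x y} → x ≡ y → x ≋ y
  ≡⇒≋ refl = ≋-refl

  ≋-+ : ∀ {x x′ y y′} → x ≋ x′ → y ≋ y′ → x + y ≋ x′ + y′
  ≋-+ {x} {x′} {y} {y′} (mk≋ P∣x) (mk≋ P∣y) = mk≋ (∣-≡ (split x x′ y y′) (∣m∣n⇒∣m+n P∣x P∣y))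
    where
    split : ∀ x x′ y y′ → (x + y) - (x′ + y′) ≡ (x - x′) + (y - y′)
    split = solve-∀

  ≋-* : ∀ {x x′ y y′} → x ≋ x′ → y ≋ y′ → x * y ≋ x′ * y′
  ≋-* {x} {x′} {y} {y′} (mk≋ P∣x) (mk≋ P∣y) = mk≋ (∣-≡ (split x x′ y y′) (∣-lin y x′ P∣x P∣y))
    where
    split : ∀ x x′ y y′ → x * y - x′ * y′ ≡ y * (x - x′) + x′ * (y - y′)
    split = solve-∀


  ∣⇒≋0 : ∀ {x} → P ∣ x → x ≋ 0ℤ
  ∣⇒≋0 {x} P∣x = mk≋ (∣-≡ (ℤ.+-identityʳ x) P∣x)

  +-divMod : ∀ m → + m ≡ + (m % p) + + (m / p) * P
  +-divMod m = trans (cong +_ (m≡m%n+[m/n]*n m p))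
    (trans (ℤ.pos-+ (m % p) _) (cong (λ z → + (m % p) + z) (ℤ.pos-* (m / p) p)))

  %-≋ : ∀ m → + (m % p) ≋ + m
  %-≋ m = mk≋ (divides (- + (m / p))
    (trans (cong (λ z → + (m % p) - z) (+-divMod m)) (cancel (+ (m % p)) (+ (m / p)) P)))
    where
    cancel : ∀ r q n → r - (r + q * n) ≡ (- q) * n
    cancel = solve-∀

  %≡⇒≋ : ∀ {m n} → m % p ≡ n % p → + m ≋ + n
  %≡⇒≋ {m} {n} eq = ≋-trans (≋-sym (%-≋ m)) (≋-trans (≡⇒≋ (cong +_ eq)) (%-≋ n))

  %≡-by-multiple : ∀ m n k → + m - + n ≡ + k * P → m % p ≡ n % p
  %≡-by-multiple m n k eq = trans (cong (_% p) m≡n+kp) ([m+kn]%n≡m%n n k p)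
    where
    shift : ∀ m n → m ≡ n + (m - n)
    shift = solve-∀
    m≡n+kp : m ≡ n ℕ.+ k ℕ.* p
    m≡n+kp = ℤ.+-injective (trans (shift (+ m) (+ n)) (trans (cong (λ z → + n + z) eq)
               (trans (cong (λ z → + n + z) (sym (ℤ.pos-* k p))) (sym (ℤ.pos-+ n (k ℕ.* p))))))

  ≋⇒%≡ : ∀ {m n} → + m ≋ + n → m % p ≡ n % p
  ≋⇒%≡ {m} {n} (mk≋ (divides (+ k) eq)) = %≡-by-multiple m n k eq
  ≋⇒%≡ {m} {n} (mk≋ (divides -[1+ k ] eq)) = sym (%≡-by-multiple n m (suc k)
    (trans (flip (+ m) (+ n)) (trans (cong -_ eq) (ℤ.neg-distribˡ-* -[1+ k ] P))))
    where
    flip : ∀ a b → b - a ≡ - (a - b)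
    flip = solve-∀

  sameMod⇒≋ : ∀ {m n} → T (sameMod p m n) → + m ≋ + n
  sameMod⇒≋ {m} {n} same = %≡⇒≋ (ℕ.≡ᵇ⇒≡ (m % p) (n % p) same)

  ≋⇒sameMod : ∀ {m n} → + m ≋ + n → T (sameMod p m n)
  ≋⇒sameMod {m} {n} m≋n = ℕ.≡⇒≡ᵇ (m % p) (n % p) (≋⇒%≡ m≋n)

  ⊖-≋ : ∀ m n → + (_⊖_ p m n) ≋ + m - + n
  ⊖-≋ m n = mk≋ (divides (+ (n / p) + 1ℤ)
    (begin
      + (m ℕ.+ (p ℕ.∸ n % p)) - (+ m - + n)
        ≡⟨ cong₂ (λ a b → a - (+ m - b)) (ℤ.pos-+ m (p ℕ.∸ n % p)) (+-divMod n) ⟩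
      (+ m + t) - (+ m - (r + + (n / p) * P))
        ≡⟨ cong (λ q → (+ m + t) - (+ m - (r + + (n / p) * q))) (sym t+r≡P) ⟩
      (+ m + t) - (+ m - (r + + (n / p) * (t + r)))
        ≡⟨ collect (+ m) t r (+ (n / p)) ⟩
      (+ (n / p) + 1ℤ) * (t + r)
        ≡⟨ cong ((+ (n / p) + 1ℤ) *_) t+r≡P ⟩
      (+ (n / p) + 1ℤ) * P ∎))
    where
    open ≡-Reasoning
    t r : ℤ
    t = + (p ℕ.∸ n % p)
    r = + (n % p)
    t+r≡P : t + r ≡ P
    t+r≡P = trans (sym (ℤ.pos-+ (p ℕ.∸ n % p) (n % p))) (cong +_ (ℕ.m∸n+n≡m (ℕ.<⇒≤ (m%n<n n p))))
    collect : ∀ x t r a → (x + t) - (x - (r + a * (t + r))) ≡ (a + 1ℤ) * (t + r)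
    collect = solve-∀

  ⟦_⟧ : Fin p → ℤ
  ⟦ i ⟧ = + toℕ i

  ⟦⟧-injective : ∀ {i j} → ⟦ i ⟧ ≋ ⟦ j ⟧ → i ≡ j
  ⟦⟧-injective {i} {j} i≋j = toℕ-injective
    (trans (sym (m<n⇒m%n≡m (toℕ<n i))) (trans (≋⇒%≡ i≋j) (m<n⇒m%n≡m (toℕ<n j))))

  ∣⟦⟧⇒≡0 : ∀ i → P ∣ ⟦ i ⟧ → toℕ i ≡ 0
  ∣⟦⟧⇒≡0 i P∣i = trans (sym (m<n⇒m%n≡m (toℕ<n i))) (trans (≋⇒%≡ {toℕ i} {0} (∣⇒≋0 P∣i)) (m*n%n≡0 0 p))

  fromℤ : ℤ → Fin p
  fromℤ z = fromℕ< (n%ℕd<d z p)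

  ⟦fromℤ⟧-≋ : ∀ z → ⟦ fromℤ z ⟧ ≋ z
  ⟦fromℤ⟧-≋ z rewrite toℕ-fromℕ< (n%ℕd<d z p) =
    mk≋ (divides (- (z /ℕ p))
      (trans (cong (λ w → + (z %ℕ p) - w) (a≡a%ℕn+[a/ℕn]*n z p)) (cancel (+ (z %ℕ p)) (z /ℕ p) P)))
    where
    cancel : ∀ r q n → r - (r + q * n) ≡ (- q) * n
    cancel = solve-∀

  record _∣ᵥ_ (k : ℤ) (w : V) : Set where
    constructor mk∣ᵥ
    field
      ∣₁ : k ∣ proj₁ w
      ∣₂ : k ∣ proj₂ w

  record _≋ᵥ_ (u v : V) : Set where
    constructor mk≋ᵥ
    field
      ≋₁ : proj₁ u ≋ proj₁ v
      ≋₂ : proj₂ u ≋ proj₂ v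

  ·-cong : ∀ {u u′ v v′} → u ≋ᵥ u′ → v ≋ᵥ v′ → u · v ≋ u′ · v′
  ·-cong (mk≋ᵥ u₁ u₂) (mk≋ᵥ v₁ v₂) = ≋-+ (≋-* u₁ v₁) (≋-* u₂ v₂)

  ·-congˡ : ∀ u {v v′} → v ≋ᵥ v′ → u · v ≋ u · v′
  ·-congˡ u = ·-cong {u} (mk≋ᵥ ≋-refl ≋-refl)

  *ᵥ-congʳ : ∀ k {u u′} → u ≋ᵥ u′ → k *ᵥ u ≋ᵥ k *ᵥ u′
  *ᵥ-congʳ k (mk≋ᵥ u₁ u₂) = mk≋ᵥ (≋-* (≋-refl {k}) u₁) (≋-* (≋-refl {k}) u₂)

  ≋ᵥ⇒∣ᵥ : ∀ {u v} → u ≋ᵥ v → P ∣ᵥ u -ᵥ v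
  ≋ᵥ⇒∣ᵥ (mk≋ᵥ (mk≋ P∣₁) (mk≋ P∣₂)) = mk∣ᵥ P∣₁ P∣₂

  ·-∣ᵥ : ∀ u {d} → P ∣ᵥ d → P ∣ u · d
  ·-∣ᵥ (u₁ , u₂) (mk∣ᵥ P∣₁ P∣₂) = ∣-lin u₁ u₂ P∣₁ P∣₂

  ∣ᵥ-≡ : ∀ {v w} → v ≡ w → P ∣ᵥ w → P ∣ᵥ v
  ∣ᵥ-≡ refl P∣w = P∣w

  ∣ᵥ-*ᵥ : ∀ k {w} → P ∣ᵥ w → P ∣ᵥ k *ᵥ w
  ∣ᵥ-*ᵥ k (mk∣ᵥ P∣₁ P∣₂) = mk∣ᵥ (∣n⇒∣m*n k P∣₁) (∣n⇒∣m*n k P∣₂)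

  ⟦_⟧ᵥ : Pt p → V
  ⟦ x ⟧ᵥ = ⟦ proj₁ x ⟧ , ⟦ proj₂ x ⟧

  ∣ᵥ-difference⇒≡ : ∀ {x y} → P ∣ᵥ ⟦ x ⟧ᵥ -ᵥ ⟦ y ⟧ᵥ → x ≡ y
  ∣ᵥ-difference⇒≡ (mk∣ᵥ P∣₁ P∣₂) = cong₂ _,_ (⟦⟧-injective (mk≋ P∣₁)) (⟦⟧-injective (mk≋ P∣₂))

  ιᵥ : Vec2 p → V
  ιᵥ (m , n) = + m , + n

  dot-ι : ∀ u v → + dot p u v ≡ ιᵥ u · ιᵥ v
  dot-ι (u₁ , u₂) (v₁ , v₂) =
    trans (ℤ.pos-+ (u₁ ℕ.* v₁) (u₂ ℕ.* v₂)) (cong₂ _+_ (ℤ.pos-* u₁ v₁) (ℤ.pos-* u₂ v₂))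

  vsub-≋ : ∀ b a → ιᵥ (vsub p b a) ≋ᵥ ⟦ b ⟧ᵥ -ᵥ ⟦ a ⟧ᵥ
  vsub-≋ (b₁ , b₂) (a₁ , a₂) = mk≋ᵥ (⊖-≋ (toℕ b₁) (toℕ a₁)) (⊖-≋ (toℕ b₂) (toℕ a₂))

  dist-≋ : ∀ a b → + dist p a b ≋ (⟦ b ⟧ᵥ -ᵥ ⟦ a ⟧ᵥ) · (⟦ b ⟧ᵥ -ᵥ ⟦ a ⟧ᵥ)
  dist-≋ a b = ≋-trans (≡⇒≋ (dot-ι (vsub p a b) (vsub p a b)))
                (≋-trans (·-cong (vsub-≋ a b) (vsub-≋ a b)) (≡⇒≋ (·-self-swap ⟦ a ⟧ᵥ ⟦ b ⟧ᵥ)))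

  corner⇐ : ∀ a b c → P ∣ (⟦ b ⟧ᵥ -ᵥ ⟦ a ⟧ᵥ) · (⟦ c ⟧ᵥ -ᵥ ⟦ a ⟧ᵥ) → T (corner p a b c)
  corner⇐ a b c P∣ = ≋⇒sameMod (≋-trans (≡⇒≋ (dot-ι (vsub p b a) (vsub p c a)))
                                (≋-trans (·-cong (vsub-≋ b a) (vsub-≋ c a)) (∣⇒≋0 P∣)))

  onLine⇒ : ∀ v t x → T (onLine p v t x) → ⟦ v ⟧ᵥ · ⟦ x ⟧ᵥ ≋ + toℕ t
  onLine⇒ v t x on = ≋-trans (≡⇒≋ (sym (dot-ι (emb p v) (emb p x)))) (sameMod⇒≋ on)

  nonzeroPt⇒ : ∀ v → T (nonzeroPt p v) → ¬ P ∣ᵥ ⟦ v ⟧ᵥ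
  nonzeroPt⇒ (v₁ , v₂) nonzero (mk∣ᵥ P∣₁ P∣₂) =
    subst (λ m → T (not ((0 ℕ.* 0 ℕ.+ m ℕ.* m) ℕ.≡ᵇ 0))) (∣⟦⟧⇒≡0 v₂ P∣₂)
      (subst (λ m → T (not ((m ℕ.* m ℕ.+ toℕ v₂ ℕ.* toℕ v₂) ℕ.≡ᵇ 0))) (∣⟦⟧⇒≡0 v₁ P∣₁) nonzero)

  bisector-value : ∀ a b x → + dot p (emb p x) (2 ℕ.* proj₁ (vsub p b a) , 2 ℕ.* proj₂ (vsub p b a))
                              ≋ ⟦ x ⟧ᵥ · (+ 2 *ᵥ (⟦ b ⟧ᵥ -ᵥ ⟦ a ⟧ᵥ))
  bisector-value a b x = ≋-trans (≡⇒≋ (trans (dot-ι (emb p x) _) (cong₂ (λ m n → ⟦ x ⟧ᵥ · (m , n))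
                                    (ℤ.pos-* 2 (proj₁ (vsub p b a))) (ℤ.pos-* 2 (proj₂ (vsub p b a))))))
                                 (·-congˡ ⟦ x ⟧ᵥ (*ᵥ-congʳ (+ 2) (vsub-≋ b a)))

  bisector-constant : ∀ a b →
    + (_⊖_ p (norm p (emb p b)) (norm p (emb p a))) ≋ ⟦ b ⟧ᵥ · ⟦ b ⟧ᵥ - ⟦ a ⟧ᵥ · ⟦ a ⟧ᵥ
  bisector-constant a b =
    ≋-trans (⊖-≋ _ _) (≡⇒≋ (cong₂ _-_ (dot-ι (emb p b) (emb p b)) (dot-ι (emb p a) (emb p a))))

  bisector⇔ : ∀ a b x →
    T (bisector p a b x) ⇔ (⟦ x ⟧ᵥ · (+ 2 *ᵥ (⟦ b ⟧ᵥ -ᵥ ⟦ a ⟧ᵥ)) ≋ ⟦ b ⟧ᵥ · ⟦ b ⟧ᵥ - ⟦ a ⟧ᵥ · ⟦ a ⟧ᵥ)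
  bisector⇔ a b x = mk⇔
    (λ on → ≋-trans (≋-sym (bisector-value a b x)) (≋-trans (sameMod⇒≋ on) (bisector-constant a b)))
    (λ on → ≋⇒sameMod (≋-trans (bisector-value a b x) (≋-trans on (≋-sym (bisector-constant a b)))))

  allOnALine⇒ : ∀ a b c d → T (allOnALine p a b c d) →
    ∃₂ λ ν t → T (nonzeroPt p ν)
             × T (onLine p ν t a) × T (onLine p ν t b) × T (onLine p ν t c) × T (onLine p ν t d)
  allOnALine⇒ a b c d collinear =
    let ν , nonzero∧line = satisfied (any⁻ _ (points p) collinear)
        nonzero , line   = Equivalence.to T-∧ nonzero∧line
        t , on           = satisfied (any⁻ _ (allFin p) line)
        on-a , on-bcd    = Equivalence.to T-∧ on
        on-b , on-cd     = Equivalence.to T-∧ on-bcd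
        on-c , on-d      = Equivalence.to T-∧ on-cd
    in ν , t , nonzero , on-a , on-b , on-c , on-d

  on-line⇒ : ∀ ν t x y → T (onLine p ν t x) → T (onLine p ν t y) → P ∣ ⟦ ν ⟧ᵥ · (⟦ y ⟧ᵥ -ᵥ ⟦ x ⟧ᵥ)
  on-line⇒ ν t x y on-x on-y = ∣-≡ (·-distribˡ-sub ⟦ ν ⟧ᵥ ⟦ y ⟧ᵥ ⟦ x ⟧ᵥ)
    (∣-difference (≋-trans (onLine⇒ ν t y on-y) (≋-sym (onLine⇒ ν t x on-x))))

  _≟ₚ_ : (x y : Pt p) → Dec (x ≡ y)
  _≟ₚ_ = ≡-dec _≟ᶠ_ _≟ᶠ_

  NondegenerateRectangle : Pt p → Pt p → Pt p → Pt p → Set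
  NondegenerateRectangle a b c d = T (rectangle p a b c d) × T (not (allOnALine p a b c d))

  module OddPrime (prime : Prime p) (p≢2 : p ≢ 2) where

    ∣*⇒∣⊎∣ : ∀ x y → P ∣ x * y → P ∣ x ⊎ P ∣ y
    ∣*⇒∣⊎∣ x y P∣xy with euclidsLemma Int.∣ x ∣ Int.∣ y ∣ prime (subst (p ℕ.∣_) (ℤ.abs-* x y) (∣⇒∣ᵤ P∣xy))
    ... | inj₁ p∣x = inj₁ (∣ᵤ⇒∣ p∣x)
    ... | inj₂ p∣y = inj₂ (∣ᵤ⇒∣ p∣y)

    ∣-cancelˡ : ∀ {x y} → ¬ P ∣ x → P ∣ x * y → P ∣ y
    ∣-cancelˡ {x} {y} P∤x P∣xy with ∣*⇒∣⊎∣ x y P∣xy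
    ... | inj₁ P∣x = ⊥-elim (P∤x P∣x)
    ... | inj₂ P∣y = P∣y

    P∤2 : ¬ P ∣ + 2
    P∤2 P∣2 = p≢2 (ℕ.≤-antisym (ℕ.∣⇒≤ (∣⇒∣ᵤ P∣2)) (ℕ.nonTrivial⇒n>1 p ⦃ prime⇒nonTrivial prime ⦄))

    halve : ∀ {x} → P ∣ + 2 * x → P ∣ x
    halve = ∣-cancelˡ P∤2

    p-odd : p % 2 ≡ 1
    p-odd with p % 2 in p%2≡ | m%n<n p 2
    ... | 0 | _ with prime⇒irreducible prime (ℕ.m%n≡0⇒n∣m p 2 p%2≡)
    ...   | inj₂ 2≡p = ⊥-elim (p≢2 (sym 2≡p))
    p-odd | 1 | _ = refl
    p-odd | suc (suc _) | ℕ.s≤s (ℕ.s≤s ())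

    -- (p + 1) / 2, an inverse of 2 modulo the odd prime p.
    ½ : ℤ
    ½ = + suc (p / 2)

    2*½≋1 : + 2 * ½ ≋ 1ℤ
    2*½≋1 = mk≋ (divides 1ℤ (trans (cong (λ q → + 2 * q - 1ℤ) (ℤ.pos-+ 1 (p / 2)))
                                    (trans (double (+ (p / 2))) (cong (1ℤ *_) (sym P≡1+2q)))))
      where
      P≡1+2q : P ≡ 1ℤ + + (p / 2) * + 2
      P≡1+2q = trans (cong +_ (trans (m≡m%n+[m/n]*n p 2) (cong (ℕ._+ p / 2 ℕ.* 2) p-odd)))
                     (trans (ℤ.pos-+ 1 (p / 2 ℕ.* 2)) (cong (λ z → 1ℤ + z) (ℤ.pos-* (p / 2) 2)))
      double : ∀ q → + 2 * (1ℤ + q) - 1ℤ ≡ 1ℤ * (1ℤ + q * + 2)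
      double = solve-∀

    double-half : ∀ z → + 2 * ⟦ fromℤ (½ * z) ⟧ ≋ z
    double-half z = ≋-trans (≋-* (≋-refl {+ 2}) (⟦fromℤ⟧-≋ (½ * z)))
                     (≋-trans (≡⇒≋ (sym (ℤ.*-assoc (+ 2) ½ z)))
                     (≋-trans (≋-* 2*½≋1 (≋-refl {z})) (≡⇒≋ (ℤ.*-identityˡ z))))

    half : V → Pt p
    half z = fromℤ (½ * proj₁ z) , fromℤ (½ * proj₂ z)

    2*half≋ : ∀ z → + 2 *ᵥ ⟦ half z ⟧ᵥ ≋ᵥ z
    2*half≋ z = mk≋ᵥ (double-half (proj₁ z)) (double-half (proj₂ z))

    parallel-orthogonal⇒zero : ∀ u w → ¬ P ∣ u · u → P ∣ u · w → P ∣ u ⊗ w → P ∣ᵥ w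
    parallel-orthogonal⇒zero u w N∤ P∣u·w P∣u⊗w =
      mk∣ᵥ (coordinate (proj₁ w) (proj₁ u) (- proj₂ u) (cong proj₁ (decompose u w)))
           (coordinate (proj₂ w) (proj₂ u) (proj₁ u) (cong proj₂ (decompose u w)))
      where
      coordinate : ∀ wᵢ k l → (u · u) * wᵢ ≡ (u · w) * k + (u ⊗ w) * l → P ∣ wᵢ
      coordinate wᵢ k l eq =
        ∣-cancelˡ {u · u} {wᵢ} N∤ (∣-≡ eq (∣m∣n⇒∣m+n (∣m⇒∣m*n k P∣u·w) (∣m⇒∣m*n l P∣u⊗w)))

    parallel⇒multiple : ∀ u v k → ¬ P ∣ u · u → P ∣ u ⊗ v → P ∣ u · v + k * (u · u) → P ∣ᵥ v +ᵥ k *ᵥ u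
    parallel⇒multiple u v k N∤ P∣u⊗v P∣ = parallel-orthogonal⇒zero u (v +ᵥ k *ᵥ u) N∤
      (∣-≡ (·-shift u v k) P∣) (∣-≡ (⊗-shift u v k) P∣u⊗v)

    parallel-same-length⇒± : ∀ u v → ¬ P ∣ u · u → P ∣ u ⊗ v → P ∣ u · u - v · v →
      P ∣ᵥ v +ᵥ (- 1ℤ) *ᵥ u ⊎ P ∣ᵥ v +ᵥ 1ℤ *ᵥ u
    parallel-same-length⇒± u v N∤ P∣u⊗v P∣N-v² =
      map (parallel⇒multiple u v (- 1ℤ) N∤ P∣u⊗v) (parallel⇒multiple u v 1ℤ N∤ P∣u⊗v)
        (∣*⇒∣⊎∣ (u · v + (- 1ℤ) * (u · u)) (u · v + 1ℤ * (u · u))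
          (∣-≡ (difference-of-squares u v) (∣-lin (- (u ⊗ v)) (- (u · u)) P∣u⊗v P∣N-v²)))

    legs-orthogonal⇒zero : ∀ u e ν → ¬ P ∣ u · u → P ∣ u · e → ¬ P ∣ᵥ e → P ∣ u · ν → P ∣ ν · e → P ∣ᵥ ν
    legs-orthogonal⇒zero u e ν N∤ P∣u·e e≢0 P∣u·ν P∣ν·e =
      [ parallel-orthogonal⇒zero u ν N∤ P∣u·ν
          , (λ P∣u⊗e → ⊥-elim (e≢0 (parallel-orthogonal⇒zero u e N∤ P∣u·e P∣u⊗e))) ]′
        (∣*⇒∣⊎∣ (u ⊗ ν) (u ⊗ e)
          (∣-≡ (binet-cauchy u ν e) (∣m∣n⇒∣m-n (∣n⇒∣m*n (u · u) P∣ν·e) (∣n⇒∣m*n (u · ν) P∣u·e))))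

    on-bisector⇔ : ∀ a b x z → + 2 *ᵥ ⟦ x ⟧ᵥ ≋ᵥ z →
      T (bisector p a b x) ⇔ P ∣ (z -ᵥ (⟦ a ⟧ᵥ +ᵥ ⟦ b ⟧ᵥ)) · (⟦ b ⟧ᵥ -ᵥ ⟦ a ⟧ᵥ)
    on-bisector⇔ a b x z 2x≋z = mk⇔
      (λ on → ∣m+n∣n⇒∣m (∣-≡ (sym identity) (∣-difference (to on))) P∣rest)
      (λ P∣ → from (mk≋ (∣-≡ identity (∣m∣n⇒∣m+n P∣ P∣rest))))
      where
      open Equivalence (bisector⇔ a b x)
      identity : ⟦ x ⟧ᵥ · (+ 2 *ᵥ (⟦ b ⟧ᵥ -ᵥ ⟦ a ⟧ᵥ)) - (⟦ b ⟧ᵥ · ⟦ b ⟧ᵥ - ⟦ a ⟧ᵥ · ⟦ a ⟧ᵥ)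
                 ≡ (z -ᵥ (⟦ a ⟧ᵥ +ᵥ ⟦ b ⟧ᵥ)) · (⟦ b ⟧ᵥ -ᵥ ⟦ a ⟧ᵥ) + (⟦ b ⟧ᵥ -ᵥ ⟦ a ⟧ᵥ) · (+ 2 *ᵥ ⟦ x ⟧ᵥ -ᵥ z)
      identity = bisector-identity ⟦ x ⟧ᵥ ⟦ a ⟧ᵥ ⟦ b ⟧ᵥ z
      P∣rest : P ∣ (⟦ b ⟧ᵥ -ᵥ ⟦ a ⟧ᵥ) · (+ 2 *ᵥ ⟦ x ⟧ᵥ -ᵥ z)
      P∣rest = ·-∣ᵥ (⟦ b ⟧ᵥ -ᵥ ⟦ a ⟧ᵥ) (≋ᵥ⇒∣ᵥ 2x≋z)

    -- The midpoint of ab and the point a quarter-turn away from it on l_ab lie on l_cd,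
    -- and the midpoint of cd lies on l_ab.
    same-bisector⇒ : ∀ a b c d → (∀ x → bisector p a b x ≡ bisector p c d x) →
      P ∣ (⟦ b ⟧ᵥ -ᵥ ⟦ a ⟧ᵥ) ⊗ (⟦ d ⟧ᵥ -ᵥ ⟦ c ⟧ᵥ)
      × P ∣ ((⟦ c ⟧ᵥ +ᵥ ⟦ d ⟧ᵥ) -ᵥ (⟦ a ⟧ᵥ +ᵥ ⟦ b ⟧ᵥ)) · (⟦ b ⟧ᵥ -ᵥ ⟦ a ⟧ᵥ)
    same-bisector⇒ a b c d same =
      halve (∣-≡ (sym (offset-difference z (C +ᵥ D) u v))
             (∣m∣n⇒∣m-n (on-cd z′ (∣-≡ (perpendicular-offset z u) ∣0)) (on-cd z (∣-≡ (no-offset z u) ∣0)))) ,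
      Equivalence.to (on-bisector⇔ a b (half (C +ᵥ D)) (C +ᵥ D) (2*half≋ (C +ᵥ D)))
        (subst T (sym (same (half (C +ᵥ D))))
          (Equivalence.from (on-bisector⇔ c d (half (C +ᵥ D)) (C +ᵥ D) (2*half≋ (C +ᵥ D)))
            (∣-≡ (no-offset (C +ᵥ D) v) ∣0)))
      where
      A B C D u v z z′ : V
      A = ⟦ a ⟧ᵥ
      B = ⟦ b ⟧ᵥ
      C = ⟦ c ⟧ᵥ
      D = ⟦ d ⟧ᵥ
      u = B -ᵥ A
      v = D -ᵥ C
      z = A +ᵥ B
      z′ = z +ᵥ + 2 *ᵥ perp u
      on-ab : ∀ w → P ∣ (w -ᵥ z) · u → T (bisector p a b (half w))
      on-ab w = Equivalence.from (on-bisector⇔ a b (half w) w (2*half≋ w))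
      on-cd : ∀ w → P ∣ (w -ᵥ z) · u → P ∣ (w -ᵥ (C +ᵥ D)) · v
      on-cd w P∣ =
        Equivalence.to (on-bisector⇔ c d (half w) w (2*half≋ w)) (subst T (same (half w)) (on-ab w P∣))

    right-angle⇒not-collinear : ∀ a b c d →
      let u = ⟦ b ⟧ᵥ -ᵥ ⟦ a ⟧ᵥ ; e = ⟦ c ⟧ᵥ -ᵥ ⟦ a ⟧ᵥ in
      ¬ P ∣ u · u → P ∣ u · e → ¬ P ∣ᵥ e → T (not (allOnALine p a b d c))
    right-angle⇒not-collinear a b c d N∤ P∣u·e e≢0 = T-not⁺ λ collinear →
      let ν , t , nonzero , on-a , on-b , _ , on-c = allOnALine⇒ a b d c collinear
      in nonzeroPt⇒ ν nonzero (legs-orthogonal⇒zero (⟦ b ⟧ᵥ -ᵥ ⟦ a ⟧ᵥ) (⟦ c ⟧ᵥ -ᵥ ⟦ a ⟧ᵥ) ⟦ ν ⟧ᵥ N∤ P∣u·e e≢0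
           (∣-≡ (·-comm (⟦ b ⟧ᵥ -ᵥ ⟦ a ⟧ᵥ) ⟦ ν ⟧ᵥ) (on-line⇒ ν t a b on-a on-b)) (on-line⇒ ν t a c on-a on-c))

    -- d - c ≡ b - a makes abdc a parallelogram; its midpoint condition makes it right-angled at a.
    right-parallelogram : ∀ a b c d →
      let A = ⟦ a ⟧ᵥ ; B = ⟦ b ⟧ᵥ ; C = ⟦ c ⟧ᵥ ; D = ⟦ d ⟧ᵥ in
      ¬ P ∣ (B -ᵥ A) · (B -ᵥ A) → P ∣ᵥ (D -ᵥ C) +ᵥ (- 1ℤ) *ᵥ (B -ᵥ A) → P ∣ ((C +ᵥ D) -ᵥ (A +ᵥ B)) · (B -ᵥ A) →
      (c ≡ a × d ≡ b) ⊎ NondegenerateRectangle a b d c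
    right-parallelogram a b c d N∤ P∣δ P∣X = by-cases (c ≟ₚ a)
      where
      A B C D : V
      A = ⟦ a ⟧ᵥ
      B = ⟦ b ⟧ᵥ
      C = ⟦ c ⟧ᵥ
      D = ⟦ d ⟧ᵥ
      P∣T : P ∣ (B -ᵥ A) · (C -ᵥ A)
      P∣T = halve (∣-≡ (parallelogram-identity A B C D) (∣m∣n⇒∣m-n P∣X (·-∣ᵥ (B -ᵥ A) P∣δ)))
      corner-from : ∀ {x} k w → x ≡ k * ((B -ᵥ A) · (C -ᵥ A)) + w · ((D -ᵥ C) +ᵥ (- 1ℤ) *ᵥ (B -ᵥ A)) → P ∣ x
      corner-from k w eq = ∣-≡ eq (∣m∣n⇒∣m+n (∣n⇒∣m*n k P∣T) (·-∣ᵥ w P∣δ))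
      by-cases : Dec (c ≡ a) → (c ≡ a × d ≡ b) ⊎ NondegenerateRectangle a b d c
      by-cases (yes c≡a) = inj₁ (c≡a , ∣ᵥ-difference⇒≡ (∣ᵥ-≡ (difference-via A B D)
                             (subst (λ x → P ∣ᵥ (D -ᵥ ⟦ x ⟧ᵥ) +ᵥ (- 1ℤ) *ᵥ (B -ᵥ A)) c≡a P∣δ)))
      by-cases (no c≢a)  =
        inj₂ (rectangle-abdc , right-angle⇒not-collinear a b c d N∤ P∣T (c≢a ∘ ∣ᵥ-difference⇒≡))
        where
        rectangle-abdc : T (rectangle p a b d c)
        rectangle-abdc = T-∧⁺ (corner⇐ a b c P∣T)
                        (T-∧⁺ (corner⇐ b a d (corner-from (- 1ℤ) (A -ᵥ B) (corner-identity-b A B C D)))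
                        (T-∧⁺ (corner⇐ d b c (corner-from 1ℤ (D -ᵥ A) (corner-identity-d A B C D)))
                              (corner⇐ c a d (corner-from (- 1ℤ) (A -ᵥ C) (corner-identity-c A B C D)))))

    data Configuration (a b c d : Pt p) : Set where
      same           : c ≡ a → d ≡ b → Configuration a b c d
      reversed       : c ≡ b → d ≡ a → Configuration a b c d
      rectangle-abdc : NondegenerateRectangle a b d c → Configuration a b c d
      rectangle-abcd : NondegenerateRectangle a b c d → Configuration a b c d

    same-bisector-same-length⇒configuration : ∀ a b c d → ¬ T (sameMod p (dist p a b) 0) →
      (∀ x → bisector p a b x ≡ bisector p c d x) → + dist p a b ≋ + dist p c d → Configuration a b c d
    same-bisector-same-length⇒configuration a b c d dist≢0 bisectors≡ dist≋ =
      [ case-u , case-−u ]′ v≡±u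
      where
      A B C D u v : V
      A = ⟦ a ⟧ᵥ
      B = ⟦ b ⟧ᵥ
      C = ⟦ c ⟧ᵥ
      D = ⟦ d ⟧ᵥ
      u = B -ᵥ A
      v = D -ᵥ C
      P∣u⊗v : P ∣ u ⊗ v
      P∣u⊗v = proj₁ (same-bisector⇒ a b c d bisectors≡)
      P∣X : P ∣ ((C +ᵥ D) -ᵥ (A +ᵥ B)) · u
      P∣X = proj₂ (same-bisector⇒ a b c d bisectors≡)
      N∤ : ¬ P ∣ u · u
      N∤ P∣N = dist≢0 (≋⇒sameMod (≋-trans (dist-≋ a b) (∣⇒≋0 P∣N)))
      P∣N-v² : P ∣ u · u - v · v
      P∣N-v² = ∣-difference (≋-trans (≋-sym (dist-≋ a b)) (≋-trans dist≋ (dist-≋ c d)))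
      v≡±u : P ∣ᵥ v +ᵥ (- 1ℤ) *ᵥ u ⊎ P ∣ᵥ v +ᵥ 1ℤ *ᵥ u
      v≡±u = parallel-same-length⇒± u v N∤ P∣u⊗v P∣N-v²
      case-u : P ∣ᵥ v +ᵥ (- 1ℤ) *ᵥ u → Configuration a b c d
      case-u v≡u = [ (λ (c≡a , d≡b) → same c≡a d≡b) , rectangle-abdc ]′
        (right-parallelogram a b c d N∤ v≡u P∣X)
      case-−u : P ∣ᵥ v +ᵥ 1ℤ *ᵥ u → Configuration a b c d
      case-−u v≡-u = [ (λ (d≡a , c≡b) → reversed c≡b d≡a) , rectangle-abcd ]′
        (right-parallelogram a b d c N∤ (∣ᵥ-≡ (reversed-difference C D u) (∣ᵥ-*ᵥ (- 1ℤ) v≡-u))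
          (subst (λ s → P ∣ (s -ᵥ (A +ᵥ B)) · u) (+ᵥ-comm C D) P∣X))

open import Data.Bool using (_∨_)
open import Data.Bool.ListAction using (any)
open import Data.Bool.Solver using (module ∨-∧-Solver)
open import Data.Fin using (Fin; toℕ; fromℕ<)
open import Data.Fin.Properties using (_≟_; toℕ-fromℕ<)
open import Data.List using (List; allFin; cartesianProduct)
open import Data.List.Membership.Propositional using (_∈_; lose)
open import Data.List.Membership.Propositional.Properties using (∈-allFin; ∈-cartesianProduct⁺)
import Data.List.Relation.Unary.All as All
open import Data.List.Relation.Unary.All.Properties using (all⁺; all⁻)
open import Data.List.Relation.Unary.Any.Properties using (any⁺)
import Data.Integer as ℤ
import Data.Nat as ℕ
open import Data.Nat using (ℕ; _+_; _*_; _≤_; NonZero)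
open import Data.Nat.DivMod using (_%_; m%n<n)
open import Data.Nat.Primality using (Prime)
open import Data.Nat.Properties hiding (_≟_)
open import Data.Nat.Tactic.RingSolver using (solve-∀)
open import Data.Product using (_×_; _,_; proj₁; proj₂; ∃-syntax)
open import Function using (_⇔_; mk⇔; _∘_)
open import Relation.Binary.PropositionalEquality
open import Relation.Nullary using (no)
open import Relation.Nullary.Decidable using (dec-true)
open import Defs renaming (_≈_ to sameMod)
open FiniteSums

regroup : ∀ a b c d m n s → (a ∧ b ∧ c ∧ d) ∧ m ∧ n ∧ s ≡ (a ∧ b ∧ m) ∧ (c ∧ d ∧ n) ∧ s
regroup = solve 7 (λ a b c d m n s →
  (a :* (b :* (c :* d))) :* (m :* (n :* s)) := (a :* (b :* m)) :* ((c :* (d :* n)) :* s)) refl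
  where open ∨-∧-Solver using (solve; _:=_; _:*_)

module Counting (p : ℕ) ⦃ _ : NonZero p ⦄ where

  open ModularPlane p

  pts : List (Pt p)
  pts = points p

  ∈-points : ∀ x → x ∈ pts
  ∈-points (x₁ , x₂) = ∈-cartesianProduct⁺ (∈-allFin x₁) (∈-allFin x₂)

  sameSet⇔ : ∀ S U → T (sameSet p S U) ⇔ (∀ x → S x ≡ U x)
  sameSet⇔ S U = mk⇔
    (λ same x → agree (All.lookup (all⁺ agrees pts same) (∈-points x)))
    (λ S≗U → all⁻ agrees {pts} (All.tabulate (λ {x} _ → agree⁻ (S≗U x))))
    where
    agrees : Pt p → Bool
    agrees x = (S x ∧ U x) ∨ (not (S x) ∧ not (U x))
    agree : ∀ {s u} → T ((s ∧ u) ∨ (not s ∧ not u)) → s ≡ u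
    agree {true}  {true}  _ = refl
    agree {false} {false} _ = refl
    agree⁻ : ∀ {s u} → s ≡ u → T ((s ∧ u) ∨ (not s ∧ not u))
    agree⁻ {true}  refl = _
    agree⁻ {false} refl = _

  ∑⁴ : (Pt p → Pt p → Pt p → Pt p → ℕ) → ℕ
  ∑⁴ h = ∑[ a ∈ pts ] ∑[ b ∈ pts ] ∑[ c ∈ pts ] ∑[ d ∈ pts ] h a b c d

  ∑⁴-cong : ∀ {h k} → (∀ a b c d → h a b c d ≡ k a b c d) → ∑⁴ h ≡ ∑⁴ k
  ∑⁴-cong h≗k = ∑-cong (λ a → ∑-cong (λ b → ∑-cong (λ c → ∑-cong (h≗k a b c) pts) pts) pts) pts

  ∑⁴-mono-≤ : ∀ {h k} → (∀ a b c d → h a b c d ≤ k a b c d) → ∑⁴ h ≤ ∑⁴ k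
  ∑⁴-mono-≤ h≤k = ∑-mono-≤ (λ a → ∑-mono-≤ (λ b → ∑-mono-≤ (λ c → ∑-mono-≤ (h≤k a b c) pts) pts) pts) pts

  ∑⁴-distrib-+ : ∀ h k → ∑⁴ (λ a b c d → h a b c d + k a b c d) ≡ ∑⁴ h + ∑⁴ k
  ∑⁴-distrib-+ h k =
    trans (∑-cong (λ a → trans (∑-cong (λ b → trans (∑-cong (λ c → ∑-distrib-+ (h a b c) (k a b c) pts) pts)
                                                   (∑-distrib-+ _ _ pts)) pts)
                               (∑-distrib-+ _ _ pts)) pts)
          (∑-distrib-+ _ _ pts)

  ∑-quads : ∀ (h : Pt p × Pt p × Pt p × Pt p → ℕ) → ∑ (quads p) h ≡ ∑⁴ (λ a b c d → h (a , b , c , d))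
  ∑-quads h = trans (∑-concatMap h _ pts) (∑-cong (λ a → trans (∑-concatMap h _ pts)
    (∑-cong (λ b → trans (∑-concatMap h _ pts) (∑-cong (λ c → ∑-map h _ pts) pts)) pts)) pts)

  Pair : Set
  Pair = Pt p × Pt p

  pairs : List Pair
  pairs = cartesianProduct pts pts

  sameBisector : Pair → Pair → Bool
  sameBisector (a , b) (c , d) = sameSet p (bisector p a b) (bisector p c d)

  sameBisector⇔ : ∀ a b c d → sameBisector (a , b) (c , d) ≡ true ⇔ (∀ x → bisector p a b x ≡ bisector p c d x)
  sameBisector⇔ a b c d = mk⇔ (Equivalence.to same ∘ ≡⇒T) (T⇒≡ ∘ Equivalence.from same)
    where
    same : T (sameSet p (bisector p a b) (bisector p c d)) ⇔ (∀ x → bisector p a b x ≡ bisector p c d x)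
    same = sameSet⇔ (bisector p a b) (bisector p c d)

  sameBisector-refl : ∀ x → sameBisector x x ≡ true
  sameBisector-refl (a , b) = Equivalence.from (sameBisector⇔ a b a b) (λ _ → refl)

  sameBisector-sym : ∀ x y → sameBisector x y ≡ true → sameBisector y x ≡ true
  sameBisector-sym (a , b) (c , d) same =
    Equivalence.from (sameBisector⇔ c d a b) (λ x → sym (Equivalence.to (sameBisector⇔ a b c d) same x))

  sameBisector-trans : ∀ x y z → sameBisector x y ≡ true → sameBisector y z ≡ true → sameBisector x z ≡ true
  sameBisector-trans (a , b) (c , d) (e , f) same₁ same₂ = Equivalence.from (sameBisector⇔ a b e f)
    (λ x → trans (Equivalence.to (sameBisector⇔ a b c d) same₁ x)
                 (Equivalence.to (sameBisector⇔ c d e f) same₂ x))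

  distanceLabel : Pair → Fin p
  distanceLabel (a , b) = fromℕ< (m%n<n (dist p a b) p)

  toℕ-distanceLabel : ∀ a b → toℕ (distanceLabel (a , b)) ≡ dist p a b % p
  toℕ-distanceLabel a b = toℕ-fromℕ< (m%n<n (dist p a b) p)

  open LabelledClasses pairs sameBisector sameBisector-refl sameBisector-sym sameBisector-trans distanceLabel

  ∑-pairs : ∀ (h : Pair → Pair → ℕ) → ∑[ x ∈ pairs ] ∑[ y ∈ pairs ] h x y ≡ ∑⁴ (λ a b c d → h (a , b) (c , d))
  ∑-pairs h = trans (∑-cartesianProduct _ pts pts)
    (∑-cong (λ a → ∑-cong (λ b → ∑-cartesianProduct (h (a , b)) pts pts) pts) pts)

  _==ₚ_ : Pt p → Pt p → Bool
  x ==ₚ y = does (proj₁ x ≟ proj₁ y) ∧ does (proj₂ x ≟ proj₂ y)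

  ≡⇒==ₚ : ∀ {x y} → x ≡ y → T (x ==ₚ y)
  ≡⇒==ₚ {x₁ , x₂} refl = T-∧⁺ (≡⇒T (dec-true (x₁ ≟ x₁) refl)) (≡⇒T (dec-true (x₂ ≟ x₂) refl))

  ∑-δₚ : ∀ a (h : Pt p → ℕ) → ∑[ c ∈ pts ] (𝟙 (c ==ₚ a) * h c) ≡ h a
  ∑-δₚ (a₁ , a₂) h = begin
    ∑[ c ∈ pts ] (𝟙 (c ==ₚ (a₁ , a₂)) * h c)
      ≡⟨ ∑-cartesianProduct _ (allFin p) (allFin p) ⟩
    ∑[ c₁ ∈ allFin p ] ∑[ c₂ ∈ allFin p ] (𝟙 (does (c₁ ≟ a₁) ∧ does (c₂ ≟ a₂)) * h (c₁ , c₂))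
      ≡⟨ ∑-cong (λ c₁ → trans (∑-cong (split c₁) (allFin p)) (∑-*ˡ (𝟙 (does (c₁ ≟ a₁))) _ (allFin p))) (allFin p) ⟩
    ∑[ c₁ ∈ allFin p ] (𝟙 (does (c₁ ≟ a₁)) * ∑[ c₂ ∈ allFin p ] (𝟙 (does (c₂ ≟ a₂)) * h (c₁ , c₂)))
      ≡⟨ ∑-cong (λ c₁ → cong (𝟙 (does (c₁ ≟ a₁)) *_) (∑-δ a₂ (λ c₂ → h (c₁ , c₂)))) (allFin p) ⟩
    ∑[ c₁ ∈ allFin p ] (𝟙 (does (c₁ ≟ a₁)) * h (c₁ , a₂))
      ≡⟨ ∑-δ a₁ (λ c₁ → h (c₁ , a₂)) ⟩
    h (a₁ , a₂) ∎
    where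
    open ≡-Reasoning
    split : ∀ c₁ c₂ → 𝟙 (does (c₁ ≟ a₁) ∧ does (c₂ ≟ a₂)) * h (c₁ , c₂)
                    ≡ 𝟙 (does (c₁ ≟ a₁)) * (𝟙 (does (c₂ ≟ a₂)) * h (c₁ , c₂))
    split c₁ c₂ = trans (cong (_* h (c₁ , c₂)) (𝟙-∧ (does (c₁ ≟ a₁)) _))
                        (*-assoc (𝟙 (does (c₁ ≟ a₁))) (𝟙 (does (c₂ ≟ a₂))) (h (c₁ , c₂)))

  module _ (E : Subset p) where

    N : ℕ
    N = card p E

    admissible : Pair → Bool
    admissible (a , b) = E a ∧ E b ∧ not (sameMod p (dist p a b) 0)

    inΔ : Fin p → Bool
    inΔ t = any (λ x → any (λ y → E x ∧ E y ∧ sameMod p (dist p x y) (toℕ t)) pts) pts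

    inΔ⁺ : ∀ x y t → T (E x) → T (E y) → ℤ.+ dist p x y ≋ ℤ.+ toℕ t → T (inΔ t)
    inΔ⁺ x y t Ex Ey dist≋t =
      any⁺ _ (lose (∈-points x) (any⁺ _ (lose (∈-points y) (T-∧⁺ Ex (T-∧⁺ Ey (≋⇒sameMod dist≋t))))))

    admissible⁻ : ∀ a b → T (admissible (a , b)) → T (E a) × T (E b) × ¬ T (sameMod p (dist p a b) 0)
    admissible⁻ a b adm =
      let Ea , Eb∧≢0 = Equivalence.to (T-∧ {E a}) adm
          Eb , ≢0    = Equivalence.to (T-∧ {E b}) Eb∧≢0
      in Ea , Eb , T-not⁻ ≢0

    admissible-labels : LabelsIn admissible inΔ
    admissible-labels (a , b) adm≡ =
      let Ea , Eb , _ = admissible⁻ a b (≡⇒T adm≡)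
      in T⇒≡ (inΔ⁺ a b (distanceLabel (a , b)) Ea Eb
                (subst (λ k → ℤ.+ dist p a b ≋ ℤ.+ k) (sym (toℕ-distanceLabel a b))
                       (≋-sym (%-≋ (dist p a b)))))

    ∑-E∧E : ∑[ a ∈ pts ] ∑[ b ∈ pts ] 𝟙 (E a ∧ E b) ≡ N * N
    ∑-E∧E = trans (∑-cong (λ a → trans (∑-cong (λ b → 𝟙-∧ (E a) (E b)) pts) (∑-*ˡ (𝟙 (E a)) _ pts)) pts)
                  (∑-*ʳ N (λ a → 𝟙 (E a)) pts)

    Qcard≡relatedSum : Qcard p E ≡ relatedSum admissible (λ _ _ → 1)
    Qcard≡relatedSum = trans (∑-quads _) (trans (∑⁴-cong term) (sym (∑-pairs _)))
      where
      term : ∀ a b c d →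
        𝟙 (inE4 p E (a , b , c , d) ∧ not (sameMod p (dist p a b) 0) ∧ not (sameMod p (dist p c d) 0)
             ∧ sameBisector (a , b) (c , d))
        ≡ 𝟙 (admissible (a , b)) * (𝟙 (admissible (c , d)) * (𝟙 (sameBisector (a , b) (c , d)) * 1))
      term a b c d = trans (cong 𝟙 (regroup (E a) (E b) (E c) (E d) _ _ _))
        (trans (𝟙-∧ (admissible (a , b)) _)
        (cong (𝟙 (admissible (a , b)) *_) (trans (𝟙-∧ (admissible (c , d)) _)
        (cong (𝟙 (admissible (c , d)) *_) (sym (*-identityʳ _))))))

    size-admissible≤N² : size admissible ≤ N * N
    size-admissible≤N² = begin
      size admissible                               ≡⟨ ∑-cartesianProduct (𝟙 ∘ admissible) pts pts ⟩
      ∑[ a ∈ pts ] ∑[ b ∈ pts ] 𝟙 (admissible (a , b))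
        ≤⟨ ∑-mono-≤ (λ a → ∑-mono-≤ (λ b → 𝟙-∧-≤ (E a) (E b) _) pts) pts ⟩
      ∑[ a ∈ pts ] ∑[ b ∈ pts ] 𝟙 (E a ∧ E b)        ≡⟨ ∑-E∧E ⟩
      N * N                                         ∎
      where open ≤-Reasoning

    Qcard≤Δcard*sameLabelPairs : Qcard p E ≤ Δcard p E * relatedSum admissible sameLabel
    Qcard≤Δcard*sameLabelPairs = begin
      Qcard p E                                     ≡⟨ Qcard≡relatedSum ⟩
      relatedSum admissible (λ _ _ → 1)             ≤⟨ relatedSum-bound admissible inΔ admissible-labels ⟩
      Δcard p E * relatedSum admissible sameLabel   ∎
      where open ≤-Reasoning

    Qcard-bound-small : N ≤ 4 → Qcard p E ≤ 16 * Δcard p E * (rectCard p E + N * N)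
    Qcard-bound-small N≤4 = begin
      Qcard p E                                     ≤⟨ Qcard≤Δcard*sameLabelPairs ⟩
      Δcard p E * relatedSum admissible sameLabel
        ≤⟨ *-monoʳ-≤ (Δcard p E) (relatedSum≤size² admissible sameLabel λ x y → 𝟙≤1 _) ⟩
      Δcard p E * (size admissible * size admissible) ≤⟨ *-monoʳ-≤ (Δcard p E) (*-mono-≤ size≤4N size≤4N) ⟩
      Δcard p E * (4 * N * (4 * N))                 ≡⟨ collect (Δcard p E) N ⟩
      16 * Δcard p E * (N * N)                      ≤⟨ *-monoʳ-≤ (16 * Δcard p E) (m≤n+m (N * N) (rectCard p E)) ⟩
      16 * Δcard p E * (rectCard p E + N * N)       ∎
      where
      open ≤-Reasoning
      size≤4N : size admissible ≤ 4 * N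
      size≤4N = ≤-trans size-admissible≤N² (*-monoˡ-≤ N N≤4)
      collect : ∀ d n → d * (4 * n * (4 * n)) ≡ 16 * d * (n * n)
      collect = solve-∀

    countedRectangle : Pt p → Pt p → Pt p → Pt p → Bool
    countedRectangle a b c d = inE4 p E (a , b , c , d) ∧ rectangle p a b c d ∧ not (allOnALine p a b c d)

    sameAs : Pt p → Pt p → Pt p → Pt p → Bool
    sameAs a b c d = c ==ₚ a ∧ d ==ₚ b ∧ E a ∧ E b

    configurations : Pt p → Pt p → Pt p → Pt p → ℕ
    configurations a b c d =
      𝟙 (sameAs a b c d) + (𝟙 (sameAs b a c d) + (𝟙 (countedRectangle a b d c) + 𝟙 (countedRectangle a b c d)))

    ∑-sameAs : ∀ a b → ∑[ c ∈ pts ] ∑[ d ∈ pts ] 𝟙 (sameAs a b c d) ≡ 𝟙 (E a ∧ E b)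
    ∑-sameAs a b = trans (∑-cong (λ c → trans (∑-cong (split c) pts)
                           (trans (∑-*ˡ (𝟙 (c ==ₚ a)) _ pts)
                                  (cong (𝟙 (c ==ₚ a) *_) (∑-δₚ b (λ _ → 𝟙 (E a ∧ E b)))))) pts)
                         (∑-δₚ a (λ _ → 𝟙 (E a ∧ E b)))
      where
      split : ∀ c d → 𝟙 (sameAs a b c d) ≡ 𝟙 (c ==ₚ a) * (𝟙 (d ==ₚ b) * 𝟙 (E a ∧ E b))
      split c d = trans (𝟙-∧ (c ==ₚ a) _) (cong (𝟙 (c ==ₚ a) *_) (𝟙-∧ (d ==ₚ b) _))

    ∑⁴-sameAs : ∑⁴ (λ a b c d → 𝟙 (sameAs a b c d)) ≡ N * N
    ∑⁴-sameAs = trans (∑-cong (λ a → ∑-cong (∑-sameAs a) pts) pts) ∑-E∧E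

    ∑⁴-sameAs-reversed : ∑⁴ (λ a b c d → 𝟙 (sameAs b a c d)) ≡ N * N
    ∑⁴-sameAs-reversed = trans (∑-cong (λ a → ∑-cong (λ b → ∑-sameAs b a) pts) pts)
                           (trans (∑-comm (λ a b → 𝟙 (E b ∧ E a)) pts pts) ∑-E∧E)

    ∑⁴-countedRectangle : ∑⁴ (λ a b c d → 𝟙 (countedRectangle a b c d)) ≡ rectCard p E
    ∑⁴-countedRectangle = sym (∑-quads _)

    ∑⁴-countedRectangle-swapped : ∑⁴ (λ a b c d → 𝟙 (countedRectangle a b d c)) ≡ rectCard p E
    ∑⁴-countedRectangle-swapped =
      trans (∑-cong (λ a → ∑-cong (λ b → ∑-comm (λ c d → 𝟙 (countedRectangle a b d c)) pts pts) pts) pts)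
            ∑⁴-countedRectangle

    ∑⁴-configurations : ∑⁴ configurations ≡ 2 * (rectCard p E + N * N)
    ∑⁴-configurations = begin
      ∑⁴ configurations
        ≡⟨ trans (∑⁴-distrib-+ same (λ a b c d → reversed a b c d + (swapped a b c d + rect a b c d)))
                 (cong (∑⁴ same +_) (trans (∑⁴-distrib-+ reversed (λ a b c d → swapped a b c d + rect a b c d))
                                           (cong (∑⁴ reversed +_) (∑⁴-distrib-+ swapped rect)))) ⟩
      ∑⁴ same + (∑⁴ reversed + (∑⁴ swapped + ∑⁴ rect))
        ≡⟨ cong₂ _+_ ∑⁴-sameAs
             (cong₂ _+_ ∑⁴-sameAs-reversed (cong₂ _+_ ∑⁴-countedRectangle-swapped ∑⁴-countedRectangle)) ⟩
      N * N + (N * N + (rectCard p E + rectCard p E))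
        ≡⟨ collect (N * N) (rectCard p E) ⟩
      2 * (rectCard p E + N * N) ∎
      where
      open ≡-Reasoning
      same reversed swapped rect : Pt p → Pt p → Pt p → Pt p → ℕ
      same     a b c d = 𝟙 (sameAs a b c d)
      reversed a b c d = 𝟙 (sameAs b a c d)
      swapped  a b c d = 𝟙 (countedRectangle a b d c)
      rect     a b c d = 𝟙 (countedRectangle a b c d)
      collect : ∀ n r → n + (n + (r + r)) ≡ 2 * (r + n)
      collect = solve-∀

    module _ (prime : Prime p) (p≢2 : p ≢ 2) where

      open OddPrime prime p≢2

      sameLabelTerm≤configurations : ∀ a b c d →
        𝟙 (admissible (a , b)) * (𝟙 (admissible (c , d))
          * (𝟙 (sameBisector (a , b) (c , d)) * sameLabel (a , b) (c , d)))
        ≤ configurations a b c d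
      sameLabelTerm≤configurations a b c d =
        𝟙⁴≤ (admissible (a , b)) (admissible (c , d)) (sameBisector (a , b) (c , d)) _ counted
        where
        counted : T (admissible (a , b)) → T (admissible (c , d)) → T (sameBisector (a , b) (c , d)) →
                T (does (distanceLabel (a , b) ≟ distanceLabel (c , d))) → 1 ≤ configurations a b c d
        counted adm₁ adm₂ bisectors labels
          with Ea , Eb , dist≢0 ← admissible⁻ a b adm₁ | Ec , Ed , _ ← admissible⁻ c d adm₂ =
          from-configuration (same-bisector-same-length⇒configuration a b c d dist≢0
                                (Equivalence.to (sameBisector⇔ a b c d) (T⇒≡ bisectors)) dist≋)
          where
          dist≋ : ℤ.+ dist p a b ≋ ℤ.+ dist p c d
          dist≋ = %≡⇒≋ (trans (sym (toℕ-distanceLabel a b))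
                          (trans (cong toℕ (T-does⇒ (distanceLabel (a , b) ≟ distanceLabel (c , d)) labels))
                                 (toℕ-distanceLabel c d)))
          t₁ t₂ t₃ t₄ : ℕ
          t₁ = 𝟙 (sameAs a b c d)
          t₂ = 𝟙 (sameAs b a c d)
          t₃ = 𝟙 (countedRectangle a b d c)
          t₄ = 𝟙 (countedRectangle a b c d)
          from-configuration : Configuration a b c d → 1 ≤ configurations a b c d
          from-configuration (same c≡a d≡b) =
            ≤-trans (T⇒1≤𝟙 (T-∧⁺ (≡⇒==ₚ c≡a) (T-∧⁺ (≡⇒==ₚ d≡b) (T-∧⁺ Ea Eb)))) (m≤m+n t₁ _)
          from-configuration (reversed c≡b d≡a) =
            ≤-trans (T⇒1≤𝟙 (T-∧⁺ (≡⇒==ₚ c≡b) (T-∧⁺ (≡⇒==ₚ d≡a) (T-∧⁺ Eb Ea))))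
                    (≤-trans (m≤m+n t₂ _) (m≤n+m _ t₁))
          from-configuration (rectangle-abdc (rect , nondegenerate)) =
            ≤-trans (T⇒1≤𝟙 (T-∧⁺ (T-∧⁺ Ea (T-∧⁺ Eb (T-∧⁺ Ed Ec))) (T-∧⁺ rect nondegenerate)))
                    (≤-trans (m≤m+n t₃ t₄) (≤-trans (m≤n+m _ t₂) (m≤n+m _ t₁)))
          from-configuration (rectangle-abcd (rect , nondegenerate)) =
            ≤-trans (T⇒1≤𝟙 (T-∧⁺ (T-∧⁺ Ea (T-∧⁺ Eb (T-∧⁺ Ec Ed))) (T-∧⁺ rect nondegenerate)))
                    (≤-trans (m≤n+m t₄ t₃) (≤-trans (m≤n+m _ t₂) (m≤n+m _ t₁)))

      Qcard-bound-odd : Qcard p E ≤ 2 * Δcard p E * (rectCard p E + N * N)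
      Qcard-bound-odd = begin
        Qcard p E                                        ≤⟨ Qcard≤Δcard*sameLabelPairs ⟩
        Δcard p E * relatedSum admissible sameLabel      ≤⟨ *-monoʳ-≤ (Δcard p E) sameLabelPairs≤ ⟩
        Δcard p E * (2 * (rectCard p E + N * N))         ≡⟨ swap (Δcard p E) (rectCard p E + N * N) ⟩
        2 * Δcard p E * (rectCard p E + N * N)           ∎
        where
        open ≤-Reasoning
        sameLabelPairs≤ : relatedSum admissible sameLabel ≤ 2 * (rectCard p E + N * N)
        sameLabelPairs≤ = begin
          relatedSum admissible sameLabel ≡⟨ ∑-pairs _ ⟩
          ∑⁴ (λ a b c d → 𝟙 (admissible (a , b)) * (𝟙 (admissible (c , d))
                          * (𝟙 (sameBisector (a , b) (c , d)) * sameLabel (a , b) (c , d))))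
                                          ≤⟨ ∑⁴-mono-≤ sameLabelTerm≤configurations ⟩
          ∑⁴ configurations               ≡⟨ ∑⁴-configurations ⟩
          2 * (rectCard p E + N * N)      ∎
        swap : ∀ d n → d * (2 * n) ≡ 2 * d * n
        swap = solve-∀

lemma2p2 : ∃[ C ] ((p : ℕ) {{_ : NonZero p}} → Prime p → (E : Subset p) →
    Qcard p E ≤ C * Δcard p E * (rectCard p E + card p E * card p E))
lemma2p2 = 16 , bound
  where
  bound : (p : ℕ) ⦃ _ : NonZero p ⦄ → Prime p → (E : Subset p) →
          Qcard p E ≤ 16 * Δcard p E * (rectCard p E + card p E * card p E)
  bound p p-prime E with p ℕ.≟ 2
  ... | yes refl = Counting.Qcard-bound-small 2 E (∑-mono-≤ (λ x → 𝟙≤1 (E x)) (points 2))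
  ... | no p≢2   = ≤-trans (Counting.Qcard-bound-odd p E p-prime p≢2)
                           (*-monoˡ-≤ (rectCard p E + card p E * card p E) (*-monoˡ-≤ (Δcard p E) (m≤m+n 2 14)))
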